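{- Let $r \ge 2$ and $s_r \ge \cdots \ge s_1 \ge 2$ be integers, let $\alpha>0$ be real, let $s := s_1+\cdots+s_r$ and $\mathbb{K} := K^r_{s_1,\ldots,s_r}$. Then for all sufficiently large $n$ the following holds. Suppose $\mathcal{H}$ is an $m$ by $n$ semibipartite $r$-graph on $V_1$ and $V_2$ such that (i) $m \le \frac{\alpha n}{8(s-s_1)}$; (ii) $d_{\mathcal{H}}(v) \ge \alpha n^{r-1}$ for every $v\in V_1$; (iii) the set $L := \left\{v\in V_1 : d_{\mathcal{H}}(v) \ge \binom{n}{r-1} - \frac{\alpha n^{r-1}}{2s_1}\right\}$ has size at least $\min\left\{\frac{5s_1(s_1-1)}{\alpha},\ \frac{s_1-1}{s_1}m\right\}$. Then $\mathcal{H}$ contains $\lfloor m/s_1\rfloor$ pairwise vertex-disjoint ordered copies of $\mathbb{K}$.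
   Context: An $r$-graph is a finite set of $r$-subsets of a vertex set; $d_{\mathcal{H}}(v)$ is the number of edges containing $v$. A semibipartite $r$-graph on $V_1,V_2$ is an $r$-graph with vertex partition $V_1\cup V_2$ in which every edge contains exactly one vertex of $V_1$; it is $m$ by $n$ if $|V_1|=m$, $|V_2|=n$. $K^r_{s_1,\ldots,s_r}=K[W_1,\dots,W_r]$ is the complete $r$-partite $r$-graph with parts $W_i$ of sizes $s_i$. An ordered copy of it in a semibipartite $r$-graph on $V_1,V_2$ is a copy with $W_1\subseteq V_1$ and $W_2,\ldots,W_r\subseteq V_2$.
   Formalization: The parameter α ranges over the positive rationals instead of the positive reals. -}

module Defs where

open import Data.Bool using (Bool; true; false; _∧_; if_then_else_)
open import Data.Nat using (ℕ; zero; suc; _+_; _*_; _∸_; _^_; _≤_; _<_; _<ᵇ_; s≤s; z≤n; NonZero; >-nonZero)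
open import Data.Nat.DivMod using (_/_)
open import Data.Nat.Combinatorics using (_C_)
open import Data.Fin using (Fin; toℕ; zero; suc)
open import Data.Fin.Subset using (Subset; ∣_∣; _∩_; _∈_; Empty)
open import Data.List using (List; []; _∷_; _++_; map; allFin)
open import Data.Nat.ListAction using (sum)
open import Data.Vec using (Vec; []; _∷_; tabulate; lookup)
open import Data.Integer using (+_)
open import Data.Rational as ℚ using (ℚ)
open import Data.Rational.Properties using (_≤?_)
open import Data.Product using (Σ; ∃; _×_)
open import Relation.Nullary using (does; ¬_)
open import Relation.Binary.PropositionalEquality using (_≡_; _≢_)
open import Function.Bundles using (_⇔_)

ℕ→ℚ : ℕ → ℚ
ℕ→ℚ k = ℚ._/_ (+ k) 1

first : {r : ℕ} → 2 ≤ r → Fin r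
first {suc _} _ = zero

sumFin : {r : ℕ} → (Fin r → ℕ) → ℕ
sumFin {r} s = sum (map s (allFin r))

floorDiv : (m d : ℕ) → 2 ≤ d → ℕ
floorDiv m zero ()
floorDiv m (suc d) _ = m / suc d

-- Vertex set V = Fin (m + n); V₁ = vertices x with toℕ x < m, V₂ = the rest.
InV1 : {m n : ℕ} → Fin (m + n) → Set
InV1 {m} x = toℕ x < m

InV2 : {m n : ℕ} → Fin (m + n) → Set
InV2 {m} x = m ≤ toℕ x

V1mask : (m n : ℕ) → Subset (m + n)
V1mask m n = tabulate (λ x → toℕ x <ᵇ m)

-- An m by n semibipartite r-graph on V₁, V₂: a finite set of r-subsets of
-- V = Fin (m + n) (given by its decidable membership predicate), each edge
-- containing exactly one vertex of V₁.
record SemibipartiteGraph (r m n : ℕ) : Set where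
  field
    edge      : Subset (m + n) → Bool
    edge-size : ∀ e → edge e ≡ true → ∣ e ∣ ≡ r
    edge-V1   : ∀ e → edge e ≡ true → ∣ e ∩ V1mask m n ∣ ≡ 1
open SemibipartiteGraph public

allSubsets : (N : ℕ) → List (Subset N)
allSubsets zero = [] ∷ []
allSubsets (suc N) = map (true ∷_) (allSubsets N) ++ map (false ∷_) (allSubsets N)

degree : {r m n : ℕ} → SemibipartiteGraph r m n → Fin (m + n) → ℕ
degree {m = m} {n} H v =
  sum (map (λ e → if edge H e ∧ lookup e v then 1 else 0) (allSubsets (m + n)))

-- |L| where L = { v ∈ V₁ : d_H(v) ≥ C(n, r-1) - α n^{r-1} / (2 s₁) },
-- the inequality written with the positive denominator 2 s₁ cleared:
-- 2 s₁ · C(n,r-1) ≤ 2 s₁ · d_H(v) + α n^{r-1}   (in ℚ)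
inL : {r m n : ℕ} → SemibipartiteGraph r m n → (s₁ : ℕ) → (α : ℚ) → Fin (m + n) → Bool
inL {r} {m} {n} H s₁ α v =
  (toℕ v <ᵇ m) ∧
  does (ℚ→ (2 * s₁ * (n C (r ∸ 1))) ≤? (ℚ→ (2 * s₁ * degree H v) ℚ.+ α ℚ.* ℚ→ (n ^ (r ∸ 1))))
  where ℚ→ = ℕ→ℚ

sizeL : {r m n : ℕ} → SemibipartiteGraph r m n → (s₁ : ℕ) → (α : ℚ) → ℕ
sizeL {m = m} {n} H s₁ α =
  sum (map (λ v → if inL H s₁ α v then 1 else 0) (allFin (m + n)))

record OrderedCopy {r m n : ℕ} (H : SemibipartiteGraph r m n)
                   (s : Fin r → ℕ) (r≥2 : 2 ≤ r) : Set where
  field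
    part      : Fin r → Subset (m + n)
    part-size : ∀ i → ∣ part i ∣ ≡ s i
    part-V1   : ∀ x → x ∈ part (first r≥2) → InV1 {m} {n} x
    part-V2   : ∀ i → i ≢ first r≥2 → ∀ x → x ∈ part i → InV2 {m} {n} x
    part-disj : ∀ i j → i ≢ j → Empty (part i ∩ part j)
    complete  : ∀ (f : Fin r → Fin (m + n)) → (∀ i → f i ∈ part i) →
                ∀ (e : Subset (m + n)) → (∀ x → (x ∈ e) ⇔ (∃ λ i → f i ≡ x)) →
                edge H e ≡ true
open OrderedCopy public

DisjointCopies : {r m n : ℕ} (H : SemibipartiteGraph r m n)
                 (s : Fin r → ℕ) (r≥2 : 2 ≤ r) (k : ℕ) → Set
DisjointCopies H s r≥2 k =
  Σ (Fin k → OrderedCopy H s r≥2) λ C →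
    ∀ a b → a ≢ b → ∀ i j → Empty (part (C a) i ∩ part (C b) j)

-- Write α = p / d and build the copies greedily, keeping the unused part R ⊆ V₁ and the used
-- part U ⊆ V₂.  While R has s₁ vertices, some s₁-set B ⊆ R has a common link (the (r-1)-sets e
-- with {v} ∪ e ∈ H for every v ∈ B) that contains, among the sets avoiding U, a fraction 1/D of
-- all (r-1)-subsets of V₂, with D depending only on s₁ and α.  By Erdős's hypergraph version of
-- the Kővári–Sós–Turán theorem such a dense family contains a complete (r-1)-partite box with
-- sides s₂, …, s_r once n is large, and the box together with B is a new ordered copy of 𝕂.
-- To find B: if at least τ ≈ 4(s₁-1)/α vertices of R lie outside L, average over the s₁-subsets
-- of τ of them; otherwise add s₁-1 vertices of L to any vertex of R, and since their links miss
-- at most α n^(r-1)/(2s₁) sets each, a union bound keeps half of the link of the first vertex.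
-- Condition (i) ensures that U meets few (r-1)-sets; condition (iii) makes the invariant that
-- selects between the two cases hold at the start, and each step preserves it.

module Submission where

open import Defs
open import Data.Nat
  using (ℕ; zero; suc; _+_; _*_; _∸_; _^_; _≤_; _<_; z≤n; s≤s; _!; _⊔_; NonZero; >-nonZero; _≡ᵇ_; _≤ᵇ_; _<ᵇ_)
open import Data.Nat.Properties
open import Data.Nat.DivMod using (_/_; _%_; m≡m%n+[m/n]*n; m%n<n; m/n*n≤m; 0/n≡0)
open import Data.Nat.Combinatorics using (_C_; nCk+nC[k+1]≡[n+1]C[k+1])
open import Data.Nat.ListAction using (sum)
open import Data.Nat.Tactic.RingSolver using (solve-∀)
open import Data.Bool as Bool using (Bool; true; false; _∧_; _∨_; not; if_then_else_; T)
open import Data.Bool.Properties as Bool using (∧-conicalˡ; ∧-conicalʳ; ∧-zeroʳ; ∧-identityʳ)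
open import Data.Bool.ListAction using (any)
open import Data.List as List using (List; []; _∷_; _++_; allFin)
open import Data.List.Properties using (length-tabulate; map-tabulate)
open import Data.List.Membership.Propositional using () renaming (_∈_ to _∈ˡ_)
open import Data.List.Membership.Propositional.Properties using (∈-allFin; ∈-map⁺; ∈-++⁺ˡ; ∈-++⁺ʳ; ∈-concatMap⁺)
open import Data.List.Relation.Unary.Any as Any using (here; there)
open import Data.Fin as Fin using (Fin; zero; suc; toℕ; _↑ˡ_; _↑ʳ_)
open import Data.Fin.Properties using (toℕ-↑ˡ; toℕ-↑ʳ; ↑ˡ-injective; ↑ʳ-injective; toℕ<n)
open import Data.Fin.Subset using (Subset; ∣_∣; ⊤; ⊥; ⁅_⁆; _∩_; _∪_; _─_; _-_; ⋃; _∈_; _⊆_; Empty)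
open import Data.Fin.Subset.Properties
  using (∣⊥∣≡0; ∣⊤∣≡n; ∣⁅x⁆∣≡1; ∣p∣≤n; ∣p∣≤∣x∷p∣; p─⊥≡p; x∈p∩q⁻; x∈p∩q⁺; ⊆-antisym; ∩-identityˡ)
open import Data.Vec as Vec using (Vec; []; _∷_; lookup; tabulate)
open import Data.Vec.Properties
  using (≡-dec; ∷-injectiveʳ; []=⇒lookup; lookup⇒[]=; tabulate-cong; lookup-zipWith; lookup-replicate;
         lookup∘tabulate; tabulate∘lookup; lookup-++ˡ; lookup-++ʳ)
open import Data.Product using (Σ; ∃; _,_; _×_; proj₁; proj₂)
open import Data.Sum using (_⊎_; inj₁; inj₂; [_,_]′)
open import Data.Rational as ℚ using (ℚ; 0ℚ)
open import Function using (_∘_)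
open import Function.Bundles using (_⇔_; Equivalence)
open import Relation.Nullary using (yes; no; does; ¬_; contradiction)
open import Relation.Nullary.Decidable using (Dec; dec-true)
open import Relation.Binary.PropositionalEquality

-- Indicators, finite sums and counting

𝟙 : Bool → ℕ
𝟙 b = if b then 1 else 0

∧-≡true : ∀ {a b} → a ≡ true → b ≡ true → a ∧ b ≡ true
∧-≡true refl refl = refl

∨≡true : ∀ a b → a ∨ b ≡ true → a ≡ true ⊎ b ≡ true
∨≡true true b _ = inj₁ refl
∨≡true false b h = inj₂ h

≤ᵇ≡true⇒≤ : ∀ {m n} → (m ≤ᵇ n) ≡ true → m ≤ n
≤ᵇ≡true⇒≤ {m} {n} h = ≤ᵇ⇒≤ m n (subst T (sym h) _)

≤ᵇ≡false⇒> : ∀ {m n} → (m ≤ᵇ n) ≡ false → n < m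
≤ᵇ≡false⇒> h = ≰⇒> (λ m≤n → subst T h (≤⇒≤ᵇ m≤n))

≡ᵇ≡true⇒≡ : ∀ {m n} → (m ≡ᵇ n) ≡ true → m ≡ n
≡ᵇ≡true⇒≡ {m} {n} h = ≡ᵇ⇒≡ m n (subst T (sym h) _)

≡⇒≡ᵇ≡true : ∀ {m n} → m ≡ n → (m ≡ᵇ n) ≡ true
≡⇒≡ᵇ≡true {m} {n} eq = Equivalence.to Bool.T-≡ (≡⇒≡ᵇ m n eq)

does≡true⇒ : ∀ {a} {A : Set a} (a? : Dec A) → does a? ≡ true → A
does≡true⇒ (yes a) _ = a
does≡true⇒ (no _) ()

-- Equal to sum ∘ List.map (sum-map≡∑), but recursive so that it stays folded on unknown lists.
∑ : ∀ {a} {A : Set a} → (A → ℕ) → List A → ℕ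
∑ f [] = 0
∑ f (x ∷ xs) = f x + ∑ f xs

sum-map≡∑ : ∀ {a} {A : Set a} (f : A → ℕ) xs → sum (List.map f xs) ≡ ∑ f xs
sum-map≡∑ f [] = refl
sum-map≡∑ f (x ∷ xs) = cong (f x +_) (sum-map≡∑ f xs)

countᵇ : ∀ {a} {A : Set a} → (A → Bool) → List A → ℕ
countᵇ P = ∑ (λ x → 𝟙 (P x))

𝟙-∨ : ∀ a b → 𝟙 (a ∨ b) ≤ 𝟙 a + 𝟙 b
𝟙-∨ true b = s≤s z≤n
𝟙-∨ false b = ≤-refl

𝟙-∧ : ∀ a b → 𝟙 (a ∧ b) ≡ 𝟙 a * 𝟙 b
𝟙-∧ true b = sym (+-identityʳ (𝟙 b))
𝟙-∧ false b = refl

module _ {a} {A : Set a} where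

  ∑-cong : ∀ {f g : A → ℕ} xs → (∀ x → f x ≡ g x) → ∑ f xs ≡ ∑ g xs
  ∑-cong [] _ = refl
  ∑-cong (x ∷ xs) f≡g = cong₂ _+_ (f≡g x) (∑-cong xs f≡g)

  ∑-mono : ∀ {f g : A → ℕ} xs → (∀ x → f x ≤ g x) → ∑ f xs ≤ ∑ g xs
  ∑-mono [] _ = z≤n
  ∑-mono (x ∷ xs) f≤g = +-mono-≤ (f≤g x) (∑-mono xs f≤g)

  ∑-mono-∈ : ∀ {f g : A → ℕ} xs → (∀ x → x ∈ˡ xs → f x ≤ g x) → ∑ f xs ≤ ∑ g xs
  ∑-mono-∈ [] _ = z≤n
  ∑-mono-∈ (x ∷ xs) f≤g = +-mono-≤ (f≤g x (here refl)) (∑-mono-∈ xs (λ y y∈ → f≤g y (there y∈)))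

  ∑-zero : ∀ {f : A → ℕ} xs → (∀ x → f x ≡ 0) → ∑ f xs ≡ 0
  ∑-zero [] _ = refl
  ∑-zero (x ∷ xs) f≡0 rewrite f≡0 x = ∑-zero xs f≡0

  ∑-+ : ∀ (f g : A → ℕ) xs → ∑ (λ x → f x + g x) xs ≡ ∑ f xs + ∑ g xs
  ∑-+ f g [] = refl
  ∑-+ f g (x ∷ xs) rewrite ∑-+ f g xs = +-+-comm (f x) (g x) (∑ f xs) (∑ g xs)
    where
    +-+-comm : ∀ a b c d → a + b + (c + d) ≡ a + c + (b + d)
    +-+-comm = solve-∀

  ∑-*ˡ : ∀ c (f : A → ℕ) xs → ∑ (λ x → c * f x) xs ≡ c * ∑ f xs
  ∑-*ˡ c f [] = sym (*-zeroʳ c)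
  ∑-*ˡ c f (x ∷ xs) rewrite ∑-*ˡ c f xs = sym (*-distribˡ-+ c (f x) (∑ f xs))

  ∑-++ : ∀ (f : A → ℕ) xs ys → ∑ f (xs ++ ys) ≡ ∑ f xs + ∑ f ys
  ∑-++ f [] ys = refl
  ∑-++ f (x ∷ xs) ys rewrite ∑-++ f xs ys = sym (+-assoc (f x) (∑ f xs) (∑ f ys))

  ∑-const : ∀ c (xs : List A) → ∑ (λ _ → c) xs ≡ List.length xs * c
  ∑-const c [] = refl
  ∑-const c (x ∷ xs) = cong (c +_) (∑-const c xs)

  term≤∑ : ∀ (f : A → ℕ) {x} xs → x ∈ˡ xs → f x ≤ ∑ f xs
  term≤∑ f (y ∷ xs) (here refl) = m≤m+n (f y) (∑ f xs)
  term≤∑ f (y ∷ xs) (there x∈) = ≤-trans (term≤∑ f xs x∈) (m≤n+m (∑ f xs) (f y))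

  countᵇ-mono : ∀ {P Q : A → Bool} xs → (∀ x → P x ≡ true → Q x ≡ true) → countᵇ P xs ≤ countᵇ Q xs
  countᵇ-mono {P} {Q} xs P⇒Q = ∑-mono xs 𝟙-mono
    where
    𝟙-mono : ∀ x → 𝟙 (P x) ≤ 𝟙 (Q x)
    𝟙-mono x with P x in Px
    ... | true rewrite P⇒Q x Px = ≤-refl
    ... | false = z≤n

  countᵇ-split : ∀ (P Q : A → Bool) xs →
                 countᵇ P xs ≡ countᵇ (λ x → P x ∧ Q x) xs + countᵇ (λ x → P x ∧ not (Q x)) xs
  countᵇ-split P Q xs = trans (∑-cong xs split) (∑-+ _ _ xs)
    where
    split : ∀ x → 𝟙 (P x) ≡ 𝟙 (P x ∧ Q x) + 𝟙 (P x ∧ not (Q x))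
    split x with P x | Q x
    ... | true | true = refl
    ... | true | false = refl
    ... | false | _ = refl

  ∑-𝟙* : ∀ (P : A → Bool) c xs → ∑ (λ x → 𝟙 (P x) * c) xs ≡ countᵇ P xs * c
  ∑-𝟙* P c [] = refl
  ∑-𝟙* P c (x ∷ xs) rewrite ∑-𝟙* P c xs = sym (*-distribʳ-+ c (𝟙 (P x)) (countᵇ P xs))

  countᵇ-pos : ∀ {P : A → Bool} {y} xs → y ∈ˡ xs → P y ≡ true → 1 ≤ countᵇ P xs
  countᵇ-pos {P} xs y∈ Py = subst (λ b → 𝟙 b ≤ countᵇ P xs) Py (term≤∑ (λ z → 𝟙 (P z)) xs y∈)

  ∃-maximiser : ∀ (P : A → Bool) (f : A → ℕ) xs → 1 ≤ countᵇ P xs →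
                Σ A λ x → P x ≡ true × (∀ y → y ∈ˡ xs → P y ≡ true → f y ≤ f x)
  ∃-maximiser P f (x ∷ xs) pos with P x in Px
  ... | false with ∃-maximiser P f xs pos
  ...   | y , Py , max = y , Py , λ
          { z (here refl) Pz → contradiction (trans (sym Pz) Px) λ ()
          ; z (there z∈) → max z z∈ }
  ∃-maximiser P f (x ∷ xs) pos | true with 1 ≤? countᵇ P xs
  ... | no none = x , Px , λ
        { z (here refl) _ → ≤-refl
        ; z (there z∈) Pz → contradiction (countᵇ-pos xs z∈ Pz) none }
  ... | yes some with ∃-maximiser P f xs some
  ...   | y , Py , max with ≤-total (f x) (f y)
  ...     | inj₁ fx≤fy = y , Py , λ
            { z (here refl) _ → fx≤fy
            ; z (there z∈) → max z z∈ }
  ...     | inj₂ fy≤fx = x , Px , λ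
            { z (here refl) _ → ≤-refl
            ; z (there z∈) Pz → ≤-trans (max z z∈ Pz) fy≤fx }

  average≤max : ∀ (P : A → Bool) (f : A → ℕ) xs → 1 ≤ countᵇ P xs →
                Σ A λ x → P x ≡ true × ∑ (λ y → 𝟙 (P y) * f y) xs ≤ countᵇ P xs * f x
  average≤max P f xs pos with ∃-maximiser P f xs pos
  ... | x , Px , max = x , Px , ≤-trans (∑-mono-∈ xs bound) (≤-reflexive (∑-𝟙* P (f x) xs))
    where
    bound : ∀ y → y ∈ˡ xs → 𝟙 (P y) * f y ≤ 𝟙 (P y) * f x
    bound y y∈ with P y in Py
    ... | true = +-monoˡ-≤ 0 (max y y∈ Py)
    ... | false = z≤n

module _ {a b} {A : Set a} {B : Set b} where

  ∑-swap : ∀ (f : A → B → ℕ) xs ys → ∑ (λ x → ∑ (f x) ys) xs ≡ ∑ (λ y → ∑ (λ x → f x y) xs) ys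
  ∑-swap f [] ys = sym (∑-zero ys (λ _ → refl))
  ∑-swap f (x ∷ xs) ys = trans (cong (∑ (f x) ys +_) (∑-swap f xs ys)) (sym (∑-+ (f x) _ ys))

  ∑-map : ∀ (f : A → ℕ) (g : B → A) xs → ∑ f (List.map g xs) ≡ ∑ (λ x → f (g x)) xs
  ∑-map f g [] = refl
  ∑-map f g (x ∷ xs) = cong (f (g x) +_) (∑-map f g xs)

  ∑-concatMap : ∀ (f : A → ℕ) (g : B → List A) xs → ∑ f (List.concatMap g xs) ≡ ∑ (λ x → ∑ f (g x)) xs
  ∑-concatMap f g [] = refl
  ∑-concatMap f g (x ∷ xs) = trans (∑-++ f (g x) _) (cong (∑ f (g x) +_) (∑-concatMap f g xs))

  countᵇ-any≤∑ : ∀ (P : B → A → Bool) vs xs →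
                 countᵇ (λ x → any (λ v → P v x) vs) xs ≤ ∑ (λ v → countᵇ (P v) xs) vs
  countᵇ-any≤∑ P [] xs = ≤-reflexive (∑-zero xs (λ _ → refl))
  countᵇ-any≤∑ P (v ∷ vs) xs = begin
    countᵇ (λ x → P v x ∨ any (λ w → P w x) vs) xs  ≤⟨ ∑-mono xs (λ x → 𝟙-∨ (P v x) _) ⟩
    ∑ (λ x → 𝟙 (P v x) + 𝟙 (any (λ w → P w x) vs)) xs ≡⟨ ∑-+ _ _ xs ⟩
    countᵇ (P v) xs + countᵇ (λ x → any (λ w → P w x) vs) xs ≤⟨ +-monoʳ-≤ _ (countᵇ-any≤∑ P vs xs) ⟩
    countᵇ (P v) xs + ∑ (λ w → countᵇ (P w) xs) vs ∎
    where open ≤-Reasoning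

module _ {a} {A : Set a} (P : A → Bool) where

  any≡true : ∀ {x} xs → x ∈ˡ xs → P x ≡ true → any P xs ≡ true
  any≡true (y ∷ xs) (here refl) Px rewrite Px = refl
  any≡true (y ∷ xs) (there x∈) Px = trans (cong (P y ∨_) (any≡true xs x∈ Px)) (Bool.∨-zeroʳ (P y))

  any≡false : ∀ {x} xs → x ∈ˡ xs → any P xs ≡ false → P x ≡ false
  any≡false (y ∷ xs) (here refl) h = Bool.∨-conicalˡ _ _ h
  any≡false (y ∷ xs) (there x∈) h = any≡false xs x∈ (Bool.∨-conicalʳ _ _ h)

  any≡true⇒∃ : ∀ xs → any P xs ≡ true → ∃ λ x → P x ≡ true
  any≡true⇒∃ (y ∷ xs) h with P y in Py
  ... | true = y , Py
  ... | false = any≡true⇒∃ xs h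

countᵇ-const-∧ : ∀ {a} {A : Set a} b (P : A → Bool) xs → countᵇ (λ x → b ∧ P x) xs ≡ 𝟙 b * countᵇ P xs
countᵇ-const-∧ true P xs = sym (+-identityʳ _)
countᵇ-const-∧ false P xs = ∑-zero xs (λ _ → refl)

∑-tabulate-+ : ∀ {a} {A : Set a} m n (g : A → ℕ) (f : Fin (m + n) → A) →
  ∑ g (List.tabulate f) ≡ ∑ g (List.tabulate (λ i → f (i ↑ˡ n))) + ∑ g (List.tabulate (λ j → f (m ↑ʳ j)))
∑-tabulate-+ zero n g f = refl
∑-tabulate-+ (suc m) n g f =
  trans (cong (g (f zero) +_) (∑-tabulate-+ m n g (λ x → f (suc x)))) (sym (+-assoc (g (f zero)) _ _))

∑-tabulate-zero : ∀ {a} {A : Set a} n (g : A → ℕ) (f : Fin n → A) → (∀ i → g (f i) ≡ 0) → ∑ g (List.tabulate f) ≡ 0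
∑-tabulate-zero zero g f _ = refl
∑-tabulate-zero (suc n) g f g∘f≡0 rewrite g∘f≡0 zero = ∑-tabulate-zero n g (λ i → f (suc i)) (λ i → g∘f≡0 (suc i))

∑-tabulate : ∀ {a} {A : Set a} n (g : A → ℕ) (f : Fin n → A) → ∑ g (List.tabulate f) ≡ ∑ (λ i → g (f i)) (allFin n)
∑-tabulate n g f = trans (cong (∑ g) (sym (map-tabulate (λ i → i) f))) (∑-map g f (allFin n))

-- Subsets of Fin n and binomial coefficients

lookup-∩ : ∀ {n} (p q : Subset n) i → lookup (p ∩ q) i ≡ lookup p i ∧ lookup q i
lookup-∩ p q i = lookup-zipWith _∧_ i p q

lookup-∪ : ∀ {n} (p q : Subset n) i → lookup (p ∪ q) i ≡ lookup p i ∨ lookup q i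
lookup-∪ p q i = lookup-zipWith _∨_ i p q

lookup-─ : ∀ {n} (p q : Subset n) i → lookup (p ─ q) i ≡ lookup p i ∧ not (lookup q i)
lookup-─ (x ∷ p) (true ∷ q) zero = sym (∧-zeroʳ x)
lookup-─ (x ∷ p) (false ∷ q) zero = sym (∧-identityʳ x)
lookup-─ (_ ∷ p) (_ ∷ q) (suc i) = lookup-─ p q i

lookup-⊥ : ∀ {n} (i : Fin n) → lookup ⊥ i ≡ false
lookup-⊥ i = lookup-replicate i false

lookup-⁅⁆ : ∀ {n} (u v : Fin n) → lookup ⁅ u ⁆ v ≡ does (u Fin.≟ v)
lookup-⁅⁆ zero zero = refl
lookup-⁅⁆ zero (suc v) = lookup-⊥ v
lookup-⁅⁆ (suc u) zero = refl
lookup-⁅⁆ (suc u) (suc v) = lookup-⁅⁆ u v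

lookup-⁅x⁆-x : ∀ {n} (u : Fin n) → lookup ⁅ u ⁆ u ≡ true
lookup-⁅x⁆-x zero = refl
lookup-⁅x⁆-x (suc u) = lookup-⁅x⁆-x u

lookup-⁅⁆⇒≡ : ∀ {n} (u v : Fin n) → lookup ⁅ u ⁆ v ≡ true → u ≡ v
lookup-⁅⁆⇒≡ zero zero _ = refl
lookup-⁅⁆⇒≡ zero (suc v) h = contradiction (trans (sym (lookup-⊥ v)) h) λ ()
lookup-⁅⁆⇒≡ (suc u) (suc v) h = cong suc (lookup-⁅⁆⇒≡ u v h)

_⊆ᵇ_ : ∀ {n} → Subset n → Subset n → Bool
[] ⊆ᵇ [] = true
(y ∷ p) ⊆ᵇ (z ∷ q) = (not y ∨ z) ∧ (p ⊆ᵇ q)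

⊆ᵇ-sound : ∀ {n} (p q : Subset n) {i} → p ⊆ᵇ q ≡ true → lookup p i ≡ true → lookup q i ≡ true
⊆ᵇ-sound (true ∷ p) (true ∷ q) {zero} _ _ = refl
⊆ᵇ-sound (_ ∷ p) (_ ∷ q) {suc i} p⊆q = ⊆ᵇ-sound p q (∧-conicalʳ _ _ p⊆q)

⊆ᵇ-complete : ∀ {n} (p q : Subset n) → (∀ i → lookup p i ≡ true → lookup q i ≡ true) → p ⊆ᵇ q ≡ true
⊆ᵇ-complete [] [] _ = refl
⊆ᵇ-complete (true ∷ p) (y ∷ q) p⊆q rewrite p⊆q zero refl = ⊆ᵇ-complete p q (λ i → p⊆q (suc i))
⊆ᵇ-complete (false ∷ p) (y ∷ q) p⊆q = ⊆ᵇ-complete p q (λ i → p⊆q (suc i))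

intersects : ∀ {n} → Subset n → Subset n → Bool
intersects [] [] = false
intersects (y ∷ p) (z ∷ q) = (y ∧ z) ∨ intersects p q

¬intersects⇒disjoint : ∀ {n} (p q : Subset n) {i} → intersects p q ≡ false →
                       lookup p i ≡ true → lookup q i ≡ false
¬intersects⇒disjoint (true ∷ p) (false ∷ q) {zero} _ _ = refl
¬intersects⇒disjoint (y ∷ p) (z ∷ q) {suc i} h = ¬intersects⇒disjoint p q (Bool.∨-conicalʳ _ _ h)

∣∣≥1⇒lookup : ∀ {n} (p : Subset n) → 1 ≤ ∣ p ∣ → ∃ λ i → lookup p i ≡ true
∣∣≥1⇒lookup (true ∷ p) _ = zero , refl
∣∣≥1⇒lookup (false ∷ p) h = let i , pᵢ = ∣∣≥1⇒lookup p h in suc i , pᵢ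

lookup⇒∣∣≥1 : ∀ {n} (p : Subset n) {i} → lookup p i ≡ true → 1 ≤ ∣ p ∣
lookup⇒∣∣≥1 (true ∷ p) _ = s≤s z≤n
lookup⇒∣∣≥1 (false ∷ p) {suc i} h = lookup⇒∣∣≥1 p h

all-false⇒∣∣≡0 : ∀ {n} (p : Subset n) → (∀ i → lookup p i ≡ false) → ∣ p ∣ ≡ 0
all-false⇒∣∣≡0 [] _ = refl
all-false⇒∣∣≡0 (true ∷ p) h = contradiction (h zero) λ ()
all-false⇒∣∣≡0 (false ∷ p) h = all-false⇒∣∣≡0 p (λ i → h (suc i))

∣∣≡1⇒≡⁅⁆ : ∀ {n} (p : Subset n) {i} → lookup p i ≡ true → ∣ p ∣ ≡ 1 → p ≡ ⁅ i ⁆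
∣∣≡1⇒≡⁅⁆ (true ∷ p) {zero} _ ∣p∣≡1 = cong (true ∷_) (∣∣≡0⇒≡⊥ p (suc-injective ∣p∣≡1))
  where
  ∣∣≡0⇒≡⊥ : ∀ {n} (p : Subset n) → ∣ p ∣ ≡ 0 → p ≡ ⊥
  ∣∣≡0⇒≡⊥ [] _ = refl
  ∣∣≡0⇒≡⊥ (false ∷ p) h = cong (false ∷_) (∣∣≡0⇒≡⊥ p h)
∣∣≡1⇒≡⁅⁆ (true ∷ p) {suc i} pᵢ ∣p∣≡1 = contradiction (≤-trans (lookup⇒∣∣≥1 p pᵢ) (≤-reflexive (suc-injective ∣p∣≡1))) λ ()
∣∣≡1⇒≡⁅⁆ (false ∷ p) {suc i} pᵢ ∣p∣≡1 = cong (false ∷_) (∣∣≡1⇒≡⁅⁆ p pᵢ ∣p∣≡1)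

∣p∪q∣≤∣p∣+∣q∣ : ∀ {n} (p q : Subset n) → ∣ p ∪ q ∣ ≤ ∣ p ∣ + ∣ q ∣
∣p∪q∣≤∣p∣+∣q∣ [] [] = z≤n
∣p∪q∣≤∣p∣+∣q∣ (true ∷ p) (y ∷ q) = s≤s (≤-trans (∣p∪q∣≤∣p∣+∣q∣ p q) (+-monoʳ-≤ ∣ p ∣ (∣p∣≤∣x∷p∣ y q)))
∣p∪q∣≤∣p∣+∣q∣ (false ∷ p) (true ∷ q) = ≤-trans (s≤s (∣p∪q∣≤∣p∣+∣q∣ p q)) (≤-reflexive (sym (+-suc ∣ p ∣ ∣ q ∣)))
∣p∪q∣≤∣p∣+∣q∣ (false ∷ p) (false ∷ q) = ∣p∪q∣≤∣p∣+∣q∣ p q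

∣p∩q∣+∣p─q∣≡∣p∣ : ∀ {n} (p q : Subset n) → ∣ p ∩ q ∣ + ∣ p ─ q ∣ ≡ ∣ p ∣
∣p∩q∣+∣p─q∣≡∣p∣ [] [] = refl
∣p∩q∣+∣p─q∣≡∣p∣ (true ∷ p) (true ∷ q) = cong suc (∣p∩q∣+∣p─q∣≡∣p∣ p q)
∣p∩q∣+∣p─q∣≡∣p∣ (true ∷ p) (false ∷ q) = trans (+-suc _ _) (cong suc (∣p∩q∣+∣p─q∣≡∣p∣ p q))
∣p∩q∣+∣p─q∣≡∣p∣ (false ∷ p) (true ∷ q) = ∣p∩q∣+∣p─q∣≡∣p∣ p q
∣p∩q∣+∣p─q∣≡∣p∣ (false ∷ p) (false ∷ q) = ∣p∩q∣+∣p─q∣≡∣p∣ p q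

∣p─q∣+∣q∣≡∣p∣ : ∀ {n} (p q : Subset n) → q ⊆ᵇ p ≡ true → ∣ p ─ q ∣ + ∣ q ∣ ≡ ∣ p ∣
∣p─q∣+∣q∣≡∣p∣ [] [] _ = refl
∣p─q∣+∣q∣≡∣p∣ (true ∷ p) (true ∷ q) h = trans (+-suc _ _) (cong suc (∣p─q∣+∣q∣≡∣p∣ p q h))
∣p─q∣+∣q∣≡∣p∣ (true ∷ p) (false ∷ q) h = cong suc (∣p─q∣+∣q∣≡∣p∣ p q h)
∣p─q∣+∣q∣≡∣p∣ (false ∷ p) (false ∷ q) h = ∣p─q∣+∣q∣≡∣p∣ p q h

∣[p─q]∩r∣+∣q∩r∣≡∣p∩r∣ : ∀ {n} (p q r : Subset n) → q ⊆ᵇ p ≡ true →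
                        ∣ (p ─ q) ∩ r ∣ + ∣ q ∩ r ∣ ≡ ∣ p ∩ r ∣
∣[p─q]∩r∣+∣q∩r∣≡∣p∩r∣ [] [] [] _ = refl
∣[p─q]∩r∣+∣q∩r∣≡∣p∩r∣ (true ∷ p) (true ∷ q) (true ∷ r) h = trans (+-suc _ _) (cong suc (∣[p─q]∩r∣+∣q∩r∣≡∣p∩r∣ p q r h))
∣[p─q]∩r∣+∣q∩r∣≡∣p∩r∣ (true ∷ p) (true ∷ q) (false ∷ r) h = ∣[p─q]∩r∣+∣q∩r∣≡∣p∩r∣ p q r h
∣[p─q]∩r∣+∣q∩r∣≡∣p∩r∣ (true ∷ p) (false ∷ q) (true ∷ r) h = cong suc (∣[p─q]∩r∣+∣q∩r∣≡∣p∩r∣ p q r h)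
∣[p─q]∩r∣+∣q∩r∣≡∣p∩r∣ (true ∷ p) (false ∷ q) (false ∷ r) h = ∣[p─q]∩r∣+∣q∩r∣≡∣p∩r∣ p q r h
∣[p─q]∩r∣+∣q∩r∣≡∣p∩r∣ (false ∷ p) (false ∷ q) (true ∷ r) h = ∣[p─q]∩r∣+∣q∩r∣≡∣p∩r∣ p q r h
∣[p─q]∩r∣+∣q∩r∣≡∣p∩r∣ (false ∷ p) (false ∷ q) (false ∷ r) h = ∣[p─q]∩r∣+∣q∩r∣≡∣p∩r∣ p q r h

∣[p─q]─r∣+∣q─r∣≡∣p─r∣ : ∀ {n} (p q r : Subset n) → q ⊆ᵇ p ≡ true →
                        ∣ (p ─ q) ─ r ∣ + ∣ q ─ r ∣ ≡ ∣ p ─ r ∣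
∣[p─q]─r∣+∣q─r∣≡∣p─r∣ [] [] [] _ = refl
∣[p─q]─r∣+∣q─r∣≡∣p─r∣ (true ∷ p) (true ∷ q) (true ∷ r) h = ∣[p─q]─r∣+∣q─r∣≡∣p─r∣ p q r h
∣[p─q]─r∣+∣q─r∣≡∣p─r∣ (true ∷ p) (true ∷ q) (false ∷ r) h = trans (+-suc _ _) (cong suc (∣[p─q]─r∣+∣q─r∣≡∣p─r∣ p q r h))
∣[p─q]─r∣+∣q─r∣≡∣p─r∣ (true ∷ p) (false ∷ q) (true ∷ r) h = ∣[p─q]─r∣+∣q─r∣≡∣p─r∣ p q r h
∣[p─q]─r∣+∣q─r∣≡∣p─r∣ (true ∷ p) (false ∷ q) (false ∷ r) h = cong suc (∣[p─q]─r∣+∣q─r∣≡∣p─r∣ p q r h)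
∣[p─q]─r∣+∣q─r∣≡∣p─r∣ (false ∷ p) (false ∷ q) (true ∷ r) h = ∣[p─q]─r∣+∣q─r∣≡∣p─r∣ p q r h
∣[p─q]─r∣+∣q─r∣≡∣p─r∣ (false ∷ p) (false ∷ q) (false ∷ r) h = ∣[p─q]─r∣+∣q─r∣≡∣p─r∣ p q r h

∣⁅x⁆∪p∣≡1+∣p∣ : ∀ {n} (x : Fin n) (p : Subset n) → lookup p x ≡ false → ∣ ⁅ x ⁆ ∪ p ∣ ≡ suc ∣ p ∣
∣⁅x⁆∪p∣≡1+∣p∣ zero (false ∷ p) _ = cong suc (cong ∣_∣ (⊥∪p≡p p))
  where
  ⊥∪p≡p : ∀ {n} (p : Subset n) → ⊥ ∪ p ≡ p
  ⊥∪p≡p [] = refl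
  ⊥∪p≡p (x ∷ p) = cong (x ∷_) (⊥∪p≡p p)
∣⁅x⁆∪p∣≡1+∣p∣ (suc x) (true ∷ p) h = cong suc (∣⁅x⁆∪p∣≡1+∣p∣ x p h)
∣⁅x⁆∪p∣≡1+∣p∣ (suc x) (false ∷ p) h = ∣⁅x⁆∪p∣≡1+∣p∣ x p h

∣p-x∣+𝟙≡∣p∣ : ∀ {n} (p : Subset n) x → ∣ p - x ∣ + 𝟙 (lookup p x) ≡ ∣ p ∣
∣p-x∣+𝟙≡∣p∣ (true ∷ p) zero = trans (+-comm _ 1) (cong (λ q → suc ∣ q ∣) (p─⊥≡p p))
∣p-x∣+𝟙≡∣p∣ (false ∷ p) zero = trans (+-identityʳ _) (cong ∣_∣ (p─⊥≡p p))
∣p-x∣+𝟙≡∣p∣ (true ∷ p) (suc x) = cong suc (∣p-x∣+𝟙≡∣p∣ p x)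
∣p-x∣+𝟙≡∣p∣ (false ∷ p) (suc x) = ∣p-x∣+𝟙≡∣p∣ p x

∃-⊆ᵇ-ofSize : ∀ {n} (p : Subset n) t → t ≤ ∣ p ∣ → Σ (Subset n) λ q → q ⊆ᵇ p ≡ true × ∣ q ∣ ≡ t
∃-⊆ᵇ-ofSize {n} p zero _ = ⊥ , ⊆ᵇ-complete ⊥ p (λ i ⊥ᵢ → contradiction (trans (sym ⊥ᵢ) (lookup-⊥ i)) λ ()) , ∣⊥∣≡0 n
∃-⊆ᵇ-ofSize (true ∷ p) (suc t) (s≤s t≤∣p∣) =
  let q , q⊆p , ∣q∣≡t = ∃-⊆ᵇ-ofSize p t t≤∣p∣ in true ∷ q , q⊆p , cong suc ∣q∣≡t
∃-⊆ᵇ-ofSize (false ∷ p) (suc t) t<∣p∣ =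
  let q , q⊆p , ∣q∣≡t = ∃-⊆ᵇ-ofSize p (suc t) t<∣p∣ in false ∷ q , q⊆p , ∣q∣≡t

∣tabulate∣≡countᵇ : ∀ {a} {A : Set a} n (f : Fin n → A) (g : A → Bool) →
                    ∣ tabulate (λ i → g (f i)) ∣ ≡ countᵇ g (List.tabulate f)
∣tabulate∣≡countᵇ zero f g = refl
∣tabulate∣≡countᵇ (suc n) f g with g (f zero)
... | true = cong suc (∣tabulate∣≡countᵇ n (λ i → f (suc i)) g)
... | false = ∣tabulate∣≡countᵇ n (λ i → f (suc i)) g

countᵇ-lookup≡∣∣ : ∀ {n} (p : Subset n) → countᵇ (lookup p) (allFin n) ≡ ∣ p ∣
countᵇ-lookup≡∣∣ {n} p = trans (sym (∣tabulate∣≡countᵇ n (λ i → i) (lookup p))) (cong ∣_∣ (tabulate∘lookup p))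

∑-allSubsets-suc : ∀ n (f : Subset (suc n) → ℕ) →
  ∑ f (allSubsets (suc n)) ≡ ∑ (λ p → f (true ∷ p)) (allSubsets n) + ∑ (λ p → f (false ∷ p)) (allSubsets n)
∑-allSubsets-suc n f = trans (∑-++ f (List.map (true ∷_) (allSubsets n)) _)
  (cong₂ _+_ (∑-map f (true ∷_) (allSubsets n)) (∑-map f (false ∷_) (allSubsets n)))

∑-allSubsets-++ : ∀ m n (f : Subset (m + n) → ℕ) →
  ∑ f (allSubsets (m + n)) ≡ ∑ (λ p → ∑ (λ q → f (p Vec.++ q)) (allSubsets n)) (allSubsets m)
∑-allSubsets-++ zero n f = sym (+-identityʳ _)
∑-allSubsets-++ (suc m) n f = begin
  ∑ f (allSubsets (suc m + n))
    ≡⟨ ∑-allSubsets-suc (m + n) f ⟩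
  ∑ (λ p → f (true ∷ p)) (allSubsets (m + n)) + ∑ (λ p → f (false ∷ p)) (allSubsets (m + n))
    ≡⟨ cong₂ _+_ (∑-allSubsets-++ m n (λ p → f (true ∷ p))) (∑-allSubsets-++ m n (λ p → f (false ∷ p))) ⟩
  ∑ (λ p → ∑ (λ q → f ((true ∷ p) Vec.++ q)) (allSubsets n)) (allSubsets m)
    + ∑ (λ p → ∑ (λ q → f ((false ∷ p) Vec.++ q)) (allSubsets n)) (allSubsets m)
    ≡⟨ sym (∑-allSubsets-suc m _) ⟩
  ∑ (λ p → ∑ (λ q → f (p Vec.++ q)) (allSubsets n)) (allSubsets (suc m)) ∎
  where open ≡-Reasoning

∑-allSubsets-single : ∀ n (p : Subset n) (f : Subset n → ℕ) → (∀ q → q ≢ p → f q ≡ 0) →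
                      ∑ f (allSubsets n) ≡ f p
∑-allSubsets-single zero [] f _ = +-identityʳ _
∑-allSubsets-single (suc n) (true ∷ p) f vanish = begin
  ∑ f (allSubsets (suc n))
    ≡⟨ ∑-allSubsets-suc n f ⟩
  ∑ (λ q → f (true ∷ q)) (allSubsets n) + ∑ (λ q → f (false ∷ q)) (allSubsets n)
    ≡⟨ cong₂ _+_ (∑-allSubsets-single n p _ (λ q q≢p → vanish _ (q≢p ∘ ∷-injectiveʳ)))
                 (∑-zero (allSubsets n) (λ q → vanish _ λ ())) ⟩
  f (true ∷ p) + 0
    ≡⟨ +-identityʳ _ ⟩
  f (true ∷ p) ∎
  where open ≡-Reasoning
∑-allSubsets-single (suc n) (false ∷ p) f vanish =
  trans (∑-allSubsets-suc n f)
        (cong₂ _+_ (∑-zero (allSubsets n) (λ q → vanish _ λ ()))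
                   (∑-allSubsets-single n p _ (λ q q≢p → vanish _ (q≢p ∘ ∷-injectiveʳ))))

∈-allSubsets : ∀ n (p : Subset n) → p ∈ˡ allSubsets n
∈-allSubsets zero [] = here refl
∈-allSubsets (suc n) (true ∷ p) = ∈-++⁺ˡ (∈-map⁺ (true ∷_) (∈-allSubsets n p))
∈-allSubsets (suc n) (false ∷ p) = ∈-++⁺ʳ (List.map (true ∷_) (allSubsets n)) (∈-map⁺ (false ∷_) (∈-allSubsets n p))

C-suc-suc : ∀ n k → suc n C suc k ≡ n C k + n C suc k
C-suc-suc n k = sym (nCk+nC[k+1]≡[n+1]C[k+1] n k)

C-monoˡ : ∀ n k → n C k ≤ suc n C k
C-monoˡ n zero = ≤-refl
C-monoˡ n (suc k) = ≤-trans (m≤n+m _ _) (≤-reflexive (sym (C-suc-suc n k)))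

C-pos : ∀ {n k} → k ≤ n → 1 ≤ n C k
C-pos {k = zero} _ = ≤-refl
C-pos {suc n} {suc k} (s≤s k≤n) = ≤-trans (C-pos k≤n) (≤-trans (m≤m+n _ _) (≤-reflexive (sym (C-suc-suc n k))))

count-⊆ᵇ-ofSize : ∀ n (q : Subset n) t → countᵇ (λ p → (∣ p ∣ ≡ᵇ t) ∧ (p ⊆ᵇ q)) (allSubsets n) ≡ ∣ q ∣ C t
count-⊆ᵇ-ofSize zero [] zero = refl
count-⊆ᵇ-ofSize zero [] (suc t) = refl
count-⊆ᵇ-ofSize (suc n) (true ∷ q) zero =
  trans (∑-allSubsets-suc n _) (cong₂ _+_ (∑-zero (allSubsets n) (λ _ → refl)) (count-⊆ᵇ-ofSize n q zero))
count-⊆ᵇ-ofSize (suc n) (true ∷ q) (suc t) =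
  trans (∑-allSubsets-suc n _)
        (trans (cong₂ _+_ (count-⊆ᵇ-ofSize n q t) (count-⊆ᵇ-ofSize n q (suc t))) (sym (C-suc-suc ∣ q ∣ t)))
count-⊆ᵇ-ofSize (suc n) (false ∷ q) t =
  trans (∑-allSubsets-suc n _)
        (cong₂ _+_ (∑-zero (allSubsets n) (λ p → cong 𝟙 (∧-zeroʳ (suc ∣ p ∣ ≡ᵇ t)))) (count-⊆ᵇ-ofSize n q t))

count-ofSize : ∀ n t → countᵇ (λ p → ∣ p ∣ ≡ᵇ t) (allSubsets n) ≡ n C t
count-ofSize n t = begin
  countᵇ (λ p → ∣ p ∣ ≡ᵇ t) (allSubsets n)
    ≡⟨ ∑-cong (allSubsets n) (λ p → cong 𝟙 (sym (trans (cong ((∣ p ∣ ≡ᵇ t) ∧_) (⊆ᵇ-⊤ p)) (∧-identityʳ _)))) ⟩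
  countᵇ (λ p → (∣ p ∣ ≡ᵇ t) ∧ (p ⊆ᵇ ⊤)) (allSubsets n)
    ≡⟨ count-⊆ᵇ-ofSize n ⊤ t ⟩
  ∣ ⊤ {n} ∣ C t
    ≡⟨ cong (_C t) (∣⊤∣≡n n) ⟩
  n C t ∎
  where
  open ≡-Reasoning
  ⊆ᵇ-⊤ : (p : Subset n) → p ⊆ᵇ ⊤ ≡ true
  ⊆ᵇ-⊤ p = ⊆ᵇ-complete p ⊤ (λ i _ → lookup-replicate i true)

count-intersecting : ∀ n j (q : Subset n) →
  countᵇ (λ p → (∣ p ∣ ≡ᵇ suc j) ∧ intersects p q) (allSubsets n) ≤ ∣ q ∣ * (n C j)
count-intersecting zero j [] = z≤n
count-intersecting (suc n) j (true ∷ q) = begin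
  countᵇ (λ p → (∣ p ∣ ≡ᵇ suc j) ∧ intersects p (true ∷ q)) (allSubsets (suc n))
    ≡⟨ ∑-allSubsets-suc n _ ⟩
  countᵇ (λ p → (∣ p ∣ ≡ᵇ j) ∧ true) (allSubsets n) + countᵇ (λ p → (∣ p ∣ ≡ᵇ suc j) ∧ intersects p q) (allSubsets n)
    ≤⟨ +-mono-≤ (≤-reflexive (trans (∑-cong (allSubsets n) (λ p → cong 𝟙 (∧-identityʳ _))) (count-ofSize n j)))
                (count-intersecting n j q) ⟩
  n C j + ∣ q ∣ * (n C j)
    ≤⟨ *-monoʳ-≤ (suc ∣ q ∣) (C-monoˡ n j) ⟩
  suc ∣ q ∣ * (suc n C j) ∎
  where open ≤-Reasoning
count-intersecting (suc n) zero (false ∷ q) = begin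
  countᵇ (λ p → (∣ p ∣ ≡ᵇ 1) ∧ intersects p (false ∷ q)) (allSubsets (suc n))
    ≡⟨ ∑-allSubsets-suc n _ ⟩
  countᵇ (λ p → (∣ p ∣ ≡ᵇ 0) ∧ intersects p q) (allSubsets n) + countᵇ (λ p → (∣ p ∣ ≡ᵇ 1) ∧ intersects p q) (allSubsets n)
    ≡⟨ cong₂ _+_ (∑-zero (allSubsets n) (λ p → cong 𝟙 (empty-∧ p q))) refl ⟩
  countᵇ (λ p → (∣ p ∣ ≡ᵇ 1) ∧ intersects p q) (allSubsets n)
    ≤⟨ count-intersecting n zero q ⟩
  ∣ q ∣ * (n C 0) ∎
  where
  open ≤-Reasoning
  empty-∧ : ∀ {n} (p q : Subset n) → (∣ p ∣ ≡ᵇ 0) ∧ intersects p q ≡ false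
  empty-∧ [] [] = refl
  empty-∧ (true ∷ p) (_ ∷ q) = refl
  empty-∧ (false ∷ p) (_ ∷ q) = empty-∧ p q
count-intersecting (suc n) (suc j) (false ∷ q) = begin
  countᵇ (λ p → (∣ p ∣ ≡ᵇ suc (suc j)) ∧ intersects p (false ∷ q)) (allSubsets (suc n))
    ≡⟨ ∑-allSubsets-suc n _ ⟩
  countᵇ (λ p → (∣ p ∣ ≡ᵇ suc j) ∧ intersects p q) (allSubsets n) + countᵇ (λ p → (∣ p ∣ ≡ᵇ suc (suc j)) ∧ intersects p q) (allSubsets n)
    ≤⟨ +-mono-≤ (count-intersecting n j q) (count-intersecting n (suc j) q) ⟩
  ∣ q ∣ * (n C j) + ∣ q ∣ * (n C suc j)
    ≡⟨ sym (*-distribˡ-+ ∣ q ∣ _ _) ⟩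
  ∣ q ∣ * (n C j + n C suc j)
    ≡⟨ cong (∣ q ∣ *_) (sym (C-suc-suc n j)) ⟩
  ∣ q ∣ * (suc n C suc j) ∎
  where open ≤-Reasoning

∣⋃∣≤∑∣∣ : ∀ {n} (ps : List (Subset n)) → ∣ ⋃ ps ∣ ≤ ∑ ∣_∣ ps
∣⋃∣≤∑∣∣ {n} [] = ≤-reflexive (∣⊥∣≡0 n)
∣⋃∣≤∑∣∣ (p ∷ ps) = ≤-trans (∣p∪q∣≤∣p∣+∣q∣ p (⋃ ps)) (+-monoʳ-≤ ∣ p ∣ (∣⋃∣≤∑∣∣ ps))

lookup-⋃ : ∀ {n} {p} (ps : List (Subset n)) {y} → p ∈ˡ ps → lookup p y ≡ true → lookup (⋃ ps) y ≡ true
lookup-⋃ (p ∷ ps) {y} (here refl) pᵧ = trans (lookup-∪ p (⋃ ps) y) (cong (_∨ lookup (⋃ ps) y) pᵧ)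
lookup-⋃ (q ∷ ps) {y} (there p∈) pᵧ = trans (lookup-∪ q (⋃ ps) y) (trans (cong (lookup q y ∨_) (lookup-⋃ ps p∈ pᵧ)) (Bool.∨-zeroʳ _))

Empty-∩-comm : ∀ {n} (p q : Subset n) → Empty (p ∩ q) → Empty (q ∩ p)
Empty-∩-comm p q p∩q≡∅ (x , x∈) = let x∈q , x∈p = x∈p∩q⁻ q p x∈ in p∩q≡∅ (x , x∈p∩q⁺ (x∈p , x∈q))

-- Falling factorials and tuples

fallingFactorial : ℕ → ℕ → ℕ
fallingFactorial n zero = 1
fallingFactorial zero (suc k) = 0
fallingFactorial (suc n) (suc k) = suc n * fallingFactorial n k

fallingFactorial-suc : ∀ n k → fallingFactorial n (suc k) ≡ fallingFactorial n k * (n ∸ k)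
fallingFactorial-suc zero zero = refl
fallingFactorial-suc zero (suc k) = refl
fallingFactorial-suc (suc n) zero = *-comm (suc n) 1
fallingFactorial-suc (suc n) (suc k) =
  trans (cong (suc n *_) (fallingFactorial-suc n k)) (sym (*-assoc (suc n) (fallingFactorial n k) (n ∸ k)))

fallingFactorial-zero : ∀ {n k} → n < k → fallingFactorial n k ≡ 0
fallingFactorial-zero {zero} {suc k} _ = refl
fallingFactorial-zero {suc n} {suc k} (s≤s n<k) = trans (cong (suc n *_) (fallingFactorial-zero n<k)) (*-zeroʳ (suc n))

k!*C≡fallingFactorial : ∀ n k → k ! * (n C k) ≡ fallingFactorial n k
k!*C≡fallingFactorial n zero = refl
k!*C≡fallingFactorial zero (suc k) = *-zeroʳ (suc k !)
k!*C≡fallingFactorial (suc n) (suc k) = begin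
  suc k ! * (suc n C suc k)
    ≡⟨ cong (suc k ! *_) (C-suc-suc n k) ⟩
  suc k ! * (n C k + n C suc k)
    ≡⟨ *-distribˡ-+ (suc k !) (n C k) (n C suc k) ⟩
  suc k ! * (n C k) + suc k ! * (n C suc k)
    ≡⟨ cong₂ _+_ (*-assoc (suc k) (k !) (n C k)) (k!*C≡fallingFactorial n (suc k)) ⟩
  suc k * (k ! * (n C k)) + fallingFactorial n (suc k)
    ≡⟨ cong₂ _+_ (cong (suc k *_) (k!*C≡fallingFactorial n k)) (fallingFactorial-suc n k) ⟩
  suc k * ff + ff * (n ∸ k)
    ≡⟨ pascal-step ⟩
  suc n * ff ∎
  where
  open ≡-Reasoning
  ff : ℕ
  ff = fallingFactorial n k
  pascal-step : suc k * ff + ff * (n ∸ k) ≡ suc n * ff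
  pascal-step with ≤-<-connex k n
  ... | inj₁ k≤n = trans (cong (suc k * ff +_) (*-comm ff (n ∸ k)))
                         (trans (sym (*-distribʳ-+ ff (suc k) (n ∸ k))) (cong (λ x → suc x * ff) (m+[n∸m]≡n k≤n)))
  ... | inj₂ n<k rewrite fallingFactorial-zero n<k = trans (+-identityʳ _) (trans (*-zeroʳ (suc k)) (sym (*-zeroʳ (suc n))))

fallingFactorial≤^ : ∀ n k → fallingFactorial n k ≤ n ^ k
fallingFactorial≤^ n zero = ≤-refl
fallingFactorial≤^ zero (suc k) = z≤n
fallingFactorial≤^ (suc n) (suc k) = *-monoʳ-≤ (suc n) (≤-trans (fallingFactorial≤^ n k) (^-monoˡ-≤ k (n≤1+n n)))

[1+n∸k]^k≤fallingFactorial : ∀ n k → (n + 1 ∸ k) ^ k ≤ fallingFactorial n k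
[1+n∸k]^k≤fallingFactorial n zero = ≤-refl
[1+n∸k]^k≤fallingFactorial zero (suc k) = ≤-reflexive (cong (λ x → x * (1 ∸ suc k) ^ k) (0∸n≡0 k))
[1+n∸k]^k≤fallingFactorial (suc n) (suc k) =
  *-mono-≤ (≤-trans (m∸n≤m (n + 1) k) (≤-reflexive (+-comm n 1))) ([1+n∸k]^k≤fallingFactorial n k)

^-distribʳ-* : ∀ m n k → (m * n) ^ k ≡ m ^ k * n ^ k
^-distribʳ-* m n zero = refl
^-distribʳ-* m n (suc k) rewrite ^-distribʳ-* m n k = [m*n]*[a*b]≡[m*a]*[n*b] m n (m ^ k) (n ^ k)
  where
  [m*n]*[a*b]≡[m*a]*[n*b] : ∀ m n a b → (m * n) * (a * b) ≡ (m * a) * (n * b)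
  [m*n]*[a*b]≡[m*a]*[n*b] = solve-∀

C≤^ : ∀ n k → n C k ≤ n ^ k
C≤^ n k = begin
  n C k                  ≤⟨ m≤n*m (n C k) (k !) {{>-nonZero (1≤n! k)}} ⟩
  k ! * (n C k)          ≡⟨ k!*C≡fallingFactorial n k ⟩
  fallingFactorial n k   ≤⟨ fallingFactorial≤^ n k ⟩
  n ^ k                  ∎
  where open ≤-Reasoning

allTuples : ∀ n k → List (Vec (Fin n) k)
allTuples n zero = [] ∷ []
allTuples n (suc k) = List.concatMap (λ y → List.map (y ∷_) (allTuples n k)) (allFin n)

∑-allTuples-suc : ∀ n k (f : Vec (Fin n) (suc k) → ℕ) →
                  ∑ f (allTuples n (suc k)) ≡ ∑ (λ y → ∑ (λ xs → f (y ∷ xs)) (allTuples n k)) (allFin n)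
∑-allTuples-suc n k f = trans (∑-concatMap f _ (allFin n)) (∑-cong (allFin n) (λ y → ∑-map f (y ∷_) (allTuples n k)))

length-allTuples : ∀ n k → ∑ (λ _ → 1) (allTuples n k) ≡ n ^ k
length-allTuples n zero = refl
length-allTuples n (suc k) = begin
  ∑ (λ _ → 1) (allTuples n (suc k))              ≡⟨ ∑-allTuples-suc n k (λ _ → 1) ⟩
  ∑ (λ _ → ∑ (λ _ → 1) (allTuples n k)) (allFin n) ≡⟨ ∑-cong (allFin n) (λ _ → length-allTuples n k) ⟩
  ∑ (λ _ → n ^ k) (allFin n)                      ≡⟨ ∑-const (n ^ k) (allFin n) ⟩
  List.length (allFin n) * n ^ k                  ≡⟨ cong (_* n ^ k) (length-tabulate {n = n} (λ i → i)) ⟩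
  n * n ^ k                                       ∎
  where open ≡-Reasoning

∈-allTuples : ∀ {n k} (xs : Vec (Fin n) k) → xs ∈ˡ allTuples n k
∈-allTuples [] = here refl
∈-allTuples {n} {suc k} (y ∷ xs) = ∈-concatMap⁺ (λ z → List.map (z ∷_) (allTuples n k)) (Any.map (λ { refl → ∈-map⁺ (y ∷_) (∈-allTuples xs) }) (∈-allFin y))

-- Complete boxes in dense k-partite families

record Box {n k} (G : Vec (Fin n) k → Bool) (t : Fin k → ℕ) : Set where
  field
    side      : Fin k → Subset n
    side-size : ∀ i → ∣ side i ∣ ≡ t i
    inside    : ∀ xs → (∀ i → lookup (side i) (lookup xs i) ≡ true) → G xs ≡ true

neighbourhood : ∀ {n k} → (Vec (Fin n) (suc k) → Bool) → Vec (Fin n) k → Subset n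
neighbourhood G xs = tabulate (λ y → G (y ∷ xs))

n≤2Da⇒n≤4D[a+1∸t] : ∀ {n} D a t → 4 * D * t + t < n → n ≤ 2 * D * a → n ≤ 4 * D * (a + 1 ∸ t)
n≤2Da⇒n≤4D[a+1∸t] {n} D a t n-large n≤2Da =
  ≤-trans (m+n≤o⇒m≤o∸n n n+4Dt≤4D[a+1]) (≤-reflexive (sym (*-distribˡ-∸ (4 * D) (a + 1) t)))
  where
  open ≤-Reasoning
  2x+2x≡4x : ∀ D a → 2 * D * a + 2 * D * a ≡ 4 * D * a
  2x+2x≡4x = solve-∀
  n+4Dt≤4D[a+1] : n + 4 * D * t ≤ 4 * D * (a + 1)
  n+4Dt≤4D[a+1] = begin
    n + 4 * D * t          ≤⟨ +-monoʳ-≤ n (≤-trans (m≤m+n (4 * D * t) t) (<⇒≤ n-large)) ⟩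
    n + n                  ≤⟨ +-mono-≤ n≤2Da n≤2Da ⟩
    2 * D * a + 2 * D * a  ≡⟨ 2x+2x≡4x D a ⟩
    4 * D * a              ≤⟨ *-monoʳ-≤ (4 * D) (m≤m+n a 1) ⟩
    4 * D * (a + 1)        ∎

-- Call a (k-1)-tuple rich if its neighbourhood has at least n/(2D) points; at least n^(k-1)/(2D)
-- tuples are rich.  Averaging C(|N(xs)|, t₀) over t₀-sets Y gives a Y lying in the neighbourhoods
-- of an 1/(2D(4D)^t₀)-fraction of all tuples, and induction on k applies to those tuples.
module BoxStep {k} (t₀ D n : ℕ) (n-large : 4 * D * t₀ + t₀ < n) (G : Vec (Fin n) (suc k) → Bool)
               (dense : n ^ suc k ≤ D * countᵇ G (allTuples n (suc k))) where
  open ≤-Reasoning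

  private
    tuples : List (Vec (Fin n) k)
    tuples = allTuples n k
    N : Vec (Fin n) k → Subset n
    N = neighbourhood G
    E : ℕ
    E = (4 * D) ^ t₀

  n≥1 : 1 ≤ n
  n≥1 = ≤-trans (s≤s z≤n) n-large

  count≡∑∣N∣ : countᵇ G (allTuples n (suc k)) ≡ ∑ (λ xs → ∣ N xs ∣) tuples
  count≡∑∣N∣ = begin-equality
    countᵇ G (allTuples n (suc k))
      ≡⟨ ∑-allTuples-suc n k (λ ys → 𝟙 (G ys)) ⟩
    ∑ (λ y → ∑ (λ xs → 𝟙 (G (y ∷ xs))) tuples) (allFin n)
      ≡⟨ ∑-swap (λ y xs → 𝟙 (G (y ∷ xs))) (allFin n) tuples ⟩
    ∑ (λ xs → countᵇ (λ y → G (y ∷ xs)) (allFin n)) tuples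
      ≡⟨ ∑-cong tuples (λ xs → sym (∣tabulate∣≡countᵇ n (λ y → y) (λ y → G (y ∷ xs)))) ⟩
    ∑ (λ xs → ∣ N xs ∣) tuples ∎

  rich : Vec (Fin n) k → Bool
  rich xs = n ≤ᵇ 2 * D * ∣ N xs ∣

  2D∣N∣≤ : ∀ xs → 2 * D * ∣ N xs ∣ ≤ 2 * D * n * 𝟙 (rich xs) + n
  2D∣N∣≤ xs with rich xs in r
  ... | true = ≤-trans (*-monoʳ-≤ (2 * D) (∣p∣≤n (N xs)))
                        (≤-trans (≤-reflexive (sym (*-identityʳ (2 * D * n)))) (m≤m+n _ n))
  ... | false = ≤-trans (<⇒≤ (≤ᵇ≡false⇒> r)) (m≤n+m n _)

  many-rich : n ^ k ≤ 2 * D * countᵇ rich tuples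
  many-rich = *-cancelˡ-≤ n {{>-nonZero n≥1}} (+-cancelʳ-≤ (n * n ^ k) _ _ (begin
    n * n ^ k + n * n ^ k                 ≡⟨ x+x≡2x (n * n ^ k) ⟩
    2 * (n * n ^ k)                       ≤⟨ *-monoʳ-≤ 2 dense ⟩
    2 * (D * countᵇ G (allTuples n (suc k))) ≡⟨ cong (λ c → 2 * (D * c)) count≡∑∣N∣ ⟩
    2 * (D * ∑ (λ xs → ∣ N xs ∣) tuples)  ≡⟨ trans (2*[D*s]≡2D*s D _) (sym (∑-*ˡ (2 * D) _ tuples)) ⟩
    ∑ (λ xs → 2 * D * ∣ N xs ∣) tuples    ≤⟨ ∑-mono tuples 2D∣N∣≤ ⟩
    ∑ (λ xs → 2 * D * n * 𝟙 (rich xs) + n) tuples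
      ≡⟨ ∑-+ _ _ tuples ⟩
    ∑ (λ xs → 2 * D * n * 𝟙 (rich xs)) tuples + ∑ (λ _ → n) tuples
      ≡⟨ cong₂ _+_ (∑-*ˡ (2 * D * n) _ tuples) (trans (∑-const n tuples) (cong (_* n) #tuples)) ⟩
    2 * D * n * countᵇ rich tuples + n ^ k * n
      ≡⟨ cong₂ _+_ (2Dn*c≡n*[2D*c] D n _) (*-comm (n ^ k) n) ⟩
    n * (2 * D * countᵇ rich tuples) + n * n ^ k ∎))
    where
    x+x≡2x : ∀ x → x + x ≡ 2 * x
    x+x≡2x = solve-∀
    2*[D*s]≡2D*s : ∀ D s → 2 * (D * s) ≡ 2 * D * s
    2*[D*s]≡2D*s = solve-∀
    2Dn*c≡n*[2D*c] : ∀ D n c → 2 * D * n * c ≡ n * (2 * D * c)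
    2Dn*c≡n*[2D*c] = solve-∀
    #tuples : List.length tuples ≡ n ^ k
    #tuples = trans (sym (trans (∑-const 1 tuples) (*-identityʳ _))) (length-allTuples n k)

  covered : Subset n → ℕ
  covered Y = countᵇ (λ xs → Y ⊆ᵇ N xs) tuples

  ∑-covered≡∑-C : ∑ (λ Y → 𝟙 (∣ Y ∣ ≡ᵇ t₀) * covered Y) (allSubsets n) ≡ ∑ (λ xs → ∣ N xs ∣ C t₀) tuples
  ∑-covered≡∑-C = begin-equality
    ∑ (λ Y → 𝟙 (∣ Y ∣ ≡ᵇ t₀) * covered Y) (allSubsets n)
      ≡⟨ ∑-cong (allSubsets n) (λ Y → sym (∑-*ˡ (𝟙 (∣ Y ∣ ≡ᵇ t₀)) _ tuples)) ⟩
    ∑ (λ Y → ∑ (λ xs → 𝟙 (∣ Y ∣ ≡ᵇ t₀) * 𝟙 (Y ⊆ᵇ N xs)) tuples) (allSubsets n)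
      ≡⟨ ∑-swap (λ Y xs → 𝟙 (∣ Y ∣ ≡ᵇ t₀) * 𝟙 (Y ⊆ᵇ N xs)) (allSubsets n) tuples ⟩
    ∑ (λ xs → ∑ (λ Y → 𝟙 (∣ Y ∣ ≡ᵇ t₀) * 𝟙 (Y ⊆ᵇ N xs)) (allSubsets n)) tuples
      ≡⟨ ∑-cong tuples (λ xs → trans (∑-cong (allSubsets n) (λ Y → sym (𝟙-∧ (∣ Y ∣ ≡ᵇ t₀) _)))
                                     (count-⊆ᵇ-ofSize n (N xs) t₀)) ⟩
    ∑ (λ xs → ∣ N xs ∣ C t₀) tuples ∎

  rich⇒C-large : ∀ xs → n ^ t₀ * 𝟙 (rich xs) ≤ E * (t₀ ! * (∣ N xs ∣ C t₀))
  rich⇒C-large xs with rich xs in r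
  ... | false = ≤-trans (≤-reflexive (*-zeroʳ (n ^ t₀))) z≤n
  ... | true = begin
    n ^ t₀ * 1                                ≡⟨ *-identityʳ _ ⟩
    n ^ t₀                                    ≤⟨ ^-monoˡ-≤ t₀ (n≤2Da⇒n≤4D[a+1∸t] D ∣ N xs ∣ t₀ n-large (≤ᵇ≡true⇒≤ r)) ⟩
    (4 * D * (∣ N xs ∣ + 1 ∸ t₀)) ^ t₀       ≡⟨ ^-distribʳ-* (4 * D) _ t₀ ⟩
    E * (∣ N xs ∣ + 1 ∸ t₀) ^ t₀             ≤⟨ *-monoʳ-≤ E ([1+n∸k]^k≤fallingFactorial ∣ N xs ∣ t₀) ⟩
    E * fallingFactorial ∣ N xs ∣ t₀          ≡⟨ cong (E *_) (sym (k!*C≡fallingFactorial ∣ N xs ∣ t₀)) ⟩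
    E * (t₀ ! * (∣ N xs ∣ C t₀))             ∎

  #t₀-sets≥1 : 1 ≤ countᵇ (λ Y → ∣ Y ∣ ≡ᵇ t₀) (allSubsets n)
  #t₀-sets≥1 = ≤-trans (C-pos (≤-trans (m≤n+m t₀ (4 * D * t₀)) (<⇒≤ n-large))) (≤-reflexive (sym (count-ofSize n t₀)))

  covering-set : Σ (Subset n) λ Y → ∣ Y ∣ ≡ t₀ × n ^ k ≤ 2 * D * E * covered Y
  covering-set with average≤max (λ Y → ∣ Y ∣ ≡ᵇ t₀) covered (allSubsets n) #t₀-sets≥1
  ... | Y , ∣Y∣≡ᵇt₀ , average≤ = Y , ≡ᵇ≡true⇒≡ ∣Y∣≡ᵇt₀ ,
      ≤-trans many-rich (≤-trans (*-monoʳ-≤ (2 * D) #rich≤) (≤-reflexive (sym (*-assoc (2 * D) E (covered Y)))))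
    where
    a*[b*[c*d]]≡[b*c]*[a*d] : ∀ a b c d → a * (b * (c * d)) ≡ (b * c) * (a * d)
    a*[b*[c*d]]≡[b*c]*[a*d] = solve-∀
    #rich≤ : countᵇ rich tuples ≤ E * covered Y
    #rich≤ = *-cancelˡ-≤ (n ^ t₀) {{m^n≢0 n t₀ {{>-nonZero n≥1}}}} (begin
      n ^ t₀ * countᵇ rich tuples
        ≡⟨ sym (∑-*ˡ (n ^ t₀) _ tuples) ⟩
      ∑ (λ xs → n ^ t₀ * 𝟙 (rich xs)) tuples
        ≤⟨ ∑-mono tuples rich⇒C-large ⟩
      ∑ (λ xs → E * (t₀ ! * (∣ N xs ∣ C t₀))) tuples
        ≡⟨ trans (∑-*ˡ E _ tuples) (cong (E *_) (∑-*ˡ (t₀ !) _ tuples)) ⟩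
      E * (t₀ ! * ∑ (λ xs → ∣ N xs ∣ C t₀) tuples)
        ≡⟨ cong (λ s → E * (t₀ ! * s)) (sym ∑-covered≡∑-C) ⟩
      E * (t₀ ! * ∑ (λ Y → 𝟙 (∣ Y ∣ ≡ᵇ t₀) * covered Y) (allSubsets n))
        ≤⟨ *-monoʳ-≤ E (*-monoʳ-≤ (t₀ !) average≤) ⟩
      E * (t₀ ! * (countᵇ (λ Y → ∣ Y ∣ ≡ᵇ t₀) (allSubsets n) * covered Y))
        ≡⟨ cong (λ c → E * (t₀ ! * (c * covered Y))) (count-ofSize n t₀) ⟩
      E * (t₀ ! * ((n C t₀) * covered Y))
        ≡⟨ a*[b*[c*d]]≡[b*c]*[a*d] E (t₀ !) (n C t₀) (covered Y) ⟩
      (t₀ ! * (n C t₀)) * (E * covered Y)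
        ≡⟨ cong (_* (E * covered Y)) (k!*C≡fallingFactorial n t₀) ⟩
      fallingFactorial n t₀ * (E * covered Y)
        ≤⟨ *-monoˡ-≤ (E * covered Y) (fallingFactorial≤^ n t₀) ⟩
      n ^ t₀ * (E * covered Y) ∎)

dense⇒box : ∀ k (t : Fin k → ℕ) D → Σ ℕ λ n₀ → ∀ n → n₀ ≤ n → (G : Vec (Fin n) k → Bool) →
            n ^ k ≤ D * countᵇ G (allTuples n k) → Box G t
dense⇒box zero t D = 0 , λ n _ G dense → record
  { side = λ ()
  ; side-size = λ ()
  ; inside = λ { [] _ → nonempty G dense } }
  where
  nonempty : ∀ {n} (G : Vec (Fin n) 0 → Bool) → 1 ≤ D * (𝟙 (G []) + 0) → G [] ≡ true
  nonempty G dense with G []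
  ... | true = refl
  ... | false = contradiction (≤-trans dense (≤-reflexive (*-zeroʳ D))) λ ()
dense⇒box (suc k) t D with dense⇒box k (λ i → t (suc i)) (2 * D * (4 * D) ^ t zero)
... | n₁ , box-rest = suc (4 * D * t zero + t zero) ⊔ n₁ , box
  where
  box : ∀ n → suc (4 * D * t zero + t zero) ⊔ n₁ ≤ n → (G : Vec (Fin n) (suc k) → Bool) →
        n ^ suc k ≤ D * countᵇ G (allTuples n (suc k)) → Box G t
  box n n₀≤n G dense = record { side = side ; side-size = side-size ; inside = inside }
    where
    open BoxStep (t zero) D n (≤-trans (m≤m⊔n _ n₁) n₀≤n) G dense using (covering-set)
    Y : Subset n
    Y = proj₁ covering-set
    common : Box (λ xs → Y ⊆ᵇ neighbourhood G xs) (λ i → t (suc i))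
    common = box-rest n (≤-trans (m≤n⊔m _ n₁) n₀≤n) (λ xs → Y ⊆ᵇ neighbourhood G xs) (proj₂ (proj₂ covering-set))
    open Box common renaming (side to side′; side-size to side-size′; inside to inside′)
    side : Fin (suc k) → Subset n
    side zero = Y
    side (suc i) = side′ i
    side-size : ∀ i → ∣ side i ∣ ≡ t i
    side-size zero = proj₁ (proj₂ covering-set)
    side-size (suc i) = side-size′ i
    inside : ∀ xs → (∀ i → lookup (side i) (lookup xs i) ≡ true) → G xs ≡ true
    inside (y ∷ xs) in-sides = trans (sym (lookup∘tabulate (λ y → G (y ∷ xs)) y))
                                     (⊆ᵇ-sound Y (neighbourhood G xs) (inside′ xs (λ i → in-sides (suc i))) (in-sides zero))

-- Sets as tuples of distinct elements

_∈ᵛ_ : ∀ {n k} → Fin n → Vec (Fin n) k → Bool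
y ∈ᵛ [] = false
y ∈ᵛ (x ∷ xs) = does (x Fin.≟ y) ∨ y ∈ᵛ xs

entries : ∀ {n k} → Vec (Fin n) k → Subset n
entries xs = tabulate (_∈ᵛ xs)

distinct : ∀ {n k} → Vec (Fin n) k → Bool
distinct [] = true
distinct (x ∷ xs) = not (x ∈ᵛ xs) ∧ distinct xs

lookup∈ᵛ : ∀ {n k} (xs : Vec (Fin n) k) i → lookup xs i ∈ᵛ xs ≡ true
lookup∈ᵛ (x ∷ xs) zero rewrite dec-true (x Fin.≟ x) refl = refl
lookup∈ᵛ (x ∷ xs) (suc i) = trans (cong (does (x Fin.≟ lookup xs i) ∨_) (lookup∈ᵛ xs i)) (Bool.∨-zeroʳ _)

∈ᵛ⇒lookup : ∀ {n k} y (xs : Vec (Fin n) k) → y ∈ᵛ xs ≡ true → ∃ λ i → lookup xs i ≡ y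
∈ᵛ⇒lookup y (x ∷ xs) h with x Fin.≟ y
... | yes x≡y = zero , x≡y
... | no _ = let i , xsᵢ≡y = ∈ᵛ⇒lookup y xs h in suc i , xsᵢ≡y

lookup-entries : ∀ {n k} (xs : Vec (Fin n) k) i → lookup (entries xs) (lookup xs i) ≡ true
lookup-entries xs i = trans (lookup∘tabulate (_∈ᵛ xs) (lookup xs i)) (lookup∈ᵛ xs i)

distinct-injective : ∀ {n k} (xs : Vec (Fin n) k) → distinct xs ≡ true → ∀ {i j} → lookup xs i ≡ lookup xs j → i ≡ j
distinct-injective (x ∷ xs) d {zero} {zero} _ = refl
distinct-injective (x ∷ xs) d {zero} {suc j} x≡xsⱼ =
  contradiction (subst (λ z → z ∈ᵛ xs ≡ true) (sym x≡xsⱼ) (lookup∈ᵛ xs j)) (not-true (∧-conicalˡ _ _ d))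
  where
  not-true : ∀ {b} → not b ≡ true → b ≢ true
  not-true {false} _ ()
distinct-injective (x ∷ xs) d {suc i} {zero} xsᵢ≡x = sym (distinct-injective (x ∷ xs) d {zero} {suc i} (sym xsᵢ≡x))
distinct-injective (x ∷ xs) d {suc i} {suc j} eq = cong suc (distinct-injective xs (∧-conicalʳ _ _ d) eq)

enumerate : ∀ {n} (p : Subset n) → Vec (Fin n) ∣ p ∣
enumerate [] = []
enumerate (true ∷ p) = zero ∷ Vec.map suc (enumerate p)
enumerate (false ∷ p) = Vec.map suc (enumerate p)

suc∈ᵛmap-suc : ∀ {n k} (y : Fin n) (xs : Vec (Fin n) k) → suc y ∈ᵛ Vec.map suc xs ≡ y ∈ᵛ xs
suc∈ᵛmap-suc y [] = refl
suc∈ᵛmap-suc y (x ∷ xs) = cong (does (x Fin.≟ y) ∨_) (suc∈ᵛmap-suc y xs)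

zero∉ᵛmap-suc : ∀ {n k} (xs : Vec (Fin n) k) → zero ∈ᵛ Vec.map suc xs ≡ false
zero∉ᵛmap-suc [] = refl
zero∉ᵛmap-suc (x ∷ xs) = zero∉ᵛmap-suc xs

distinct-map-suc : ∀ {n k} (xs : Vec (Fin n) k) → distinct (Vec.map suc xs) ≡ distinct xs
distinct-map-suc [] = refl
distinct-map-suc (x ∷ xs) = cong₂ (λ a b → not a ∧ b) (suc∈ᵛmap-suc x xs) (distinct-map-suc xs)

distinct-enumerate : ∀ {n} (p : Subset n) → distinct (enumerate p) ≡ true
distinct-enumerate [] = refl
distinct-enumerate (true ∷ p)
  rewrite zero∉ᵛmap-suc (enumerate p) | distinct-map-suc (enumerate p) = distinct-enumerate p
distinct-enumerate (false ∷ p) rewrite distinct-map-suc (enumerate p) = distinct-enumerate p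

∈ᵛenumerate : ∀ {n} (p : Subset n) y → y ∈ᵛ enumerate p ≡ lookup p y
∈ᵛenumerate (true ∷ p) zero = refl
∈ᵛenumerate (true ∷ p) (suc y) = trans (suc∈ᵛmap-suc y (enumerate p)) (∈ᵛenumerate p y)
∈ᵛenumerate (false ∷ p) zero = zero∉ᵛmap-suc (enumerate p)
∈ᵛenumerate (false ∷ p) (suc y) = trans (suc∈ᵛmap-suc y (enumerate p)) (∈ᵛenumerate p y)

entries-enumerate : ∀ {n} (p : Subset n) → entries (enumerate p) ≡ p
entries-enumerate p = trans (tabulate-cong (∈ᵛenumerate p)) (tabulate∘lookup p)

∃-distinct-tuple : ∀ {n k} (p : Subset n) → ∣ p ∣ ≡ k → Σ (Vec (Fin n) k) λ xs → distinct xs ≡ true × entries xs ≡ p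
∃-distinct-tuple {n} p refl = enumerate p , distinct-enumerate p , entries-enumerate p

count-sets≤count-tuples : ∀ n k (F : Subset n → Bool) → (∀ p → F p ≡ true → ∣ p ∣ ≡ k) →
  countᵇ F (allSubsets n) ≤ countᵇ (λ xs → distinct xs ∧ F (entries xs)) (allTuples n k)
count-sets≤count-tuples n k F F⇒∣∣≡k = begin
  countᵇ F (allSubsets n)
    ≤⟨ ∑-mono (allSubsets n) F⇒tuple ⟩
  ∑ (λ p → ∑ (λ xs → 𝟙 (good xs ∧ does (entries xs ≟ˢ p))) (allTuples n k)) (allSubsets n)
    ≡⟨ ∑-swap (λ p xs → 𝟙 (good xs ∧ does (entries xs ≟ˢ p))) (allSubsets n) (allTuples n k) ⟩
  ∑ (λ xs → ∑ (λ p → 𝟙 (good xs ∧ does (entries xs ≟ˢ p))) (allSubsets n)) (allTuples n k)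
    ≡⟨ ∑-cong (allTuples n k) (λ xs → trans (∑-allSubsets-single n (entries xs) _ (other xs)) (itself xs)) ⟩
  countᵇ good (allTuples n k) ∎
  where
  open ≤-Reasoning
  _≟ˢ_ : ∀ (p q : Subset n) → Dec (p ≡ q)
  _≟ˢ_ = ≡-dec Bool._≟_
  good : Vec (Fin n) k → Bool
  good xs = distinct xs ∧ F (entries xs)
  other : ∀ xs p → p ≢ entries xs → 𝟙 (good xs ∧ does (entries xs ≟ˢ p)) ≡ 0
  other xs p p≢ with entries xs ≟ˢ p
  ... | yes eq = contradiction (sym eq) p≢
  ... | no _ = cong 𝟙 (∧-zeroʳ (good xs))
  itself : ∀ xs → 𝟙 (good xs ∧ does (entries xs ≟ˢ entries xs)) ≡ 𝟙 (good xs)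
  itself xs rewrite dec-true (entries xs ≟ˢ entries xs) refl = cong 𝟙 (∧-identityʳ (good xs))
  F⇒tuple : ∀ p → 𝟙 (F p) ≤ ∑ (λ xs → 𝟙 (good xs ∧ does (entries xs ≟ˢ p))) (allTuples n k)
  F⇒tuple p with F p in Fp
  ... | false = z≤n
  ... | true with ∃-distinct-tuple p (F⇒∣∣≡k p Fp)
  ...   | xs , d , refl = subst (λ b → 𝟙 b ≤ ∑ (λ ys → 𝟙 (good ys ∧ does (entries ys ≟ˢ entries xs))) (allTuples n k)) hit
                                   (term≤∑ (λ ys → 𝟙 (good ys ∧ does (entries ys ≟ˢ entries xs))) (allTuples n k) (∈-allTuples xs))
    where
    hit : good xs ∧ does (entries xs ≟ˢ entries xs) ≡ true
    hit rewrite d | Fp | dec-true (entries xs ≟ˢ entries xs) refl = refl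

-- Links and ordered copies

data Split (m n : ℕ) : Fin (m + n) → Set where
  left  : (i : Fin m) → Split m n (i ↑ˡ n)
  right : (j : Fin n) → Split m n (m ↑ʳ j)

split : ∀ m n (x : Fin (m + n)) → Split m n x
split zero n x = right x
split (suc m) n zero = left zero
split (suc m) n (suc x) with split m n x
... | left i = left (suc i)
... | right j = right j

↑ˡ≢↑ʳ : ∀ {m n} (i : Fin m) (j : Fin n) → i ↑ˡ n ≢ m ↑ʳ j
↑ˡ≢↑ʳ {m} {n} i j eq = <-irrefl refl (begin-strict
  toℕ (i ↑ˡ n)  ≡⟨ toℕ-↑ˡ i n ⟩
  toℕ i         <⟨ toℕ<n i ⟩
  m             ≤⟨ m≤m+n m (toℕ j) ⟩
  m + toℕ j     ≡⟨ sym (toℕ-↑ʳ m j) ⟩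
  toℕ (m ↑ʳ j)  ≡⟨ cong toℕ (sym eq) ⟩
  toℕ (i ↑ˡ n)  ∎)
  where open ≤-Reasoning

lookup-++⊥ : ∀ {m n} (p : Subset m) x → lookup (p Vec.++ ⊥ {n}) x ≡ true → ∃ λ i → x ≡ i ↑ˡ n × lookup p i ≡ true
lookup-++⊥ {m} {n} p x h with split m n x
... | left i = i , refl , trans (sym (lookup-++ˡ p ⊥ i)) h
... | right j = contradiction (trans (sym h) (trans (lookup-++ʳ p ⊥ j) (lookup-⊥ j))) λ ()

lookup-⊥++ : ∀ {m n} (q : Subset n) x → lookup (⊥ {m} Vec.++ q) x ≡ true → ∃ λ j → x ≡ m ↑ʳ j × lookup q j ≡ true
lookup-⊥++ {m} {n} q x h with split m n x
... | left i = contradiction (trans (sym h) (trans (lookup-++ˡ (⊥ {m}) q i) (lookup-⊥ i))) λ ()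
... | right j = j , refl , trans (sym (lookup-++ʳ (⊥ {m}) q j)) h

V1mask≡⊤++⊥ : ∀ m n → V1mask m n ≡ ⊤ {m} Vec.++ ⊥ {n}
V1mask≡⊤++⊥ zero n = nothing<0 n toℕ
  where
  nothing<0 : ∀ n (f : Fin n → ℕ) → tabulate (λ x → f x <ᵇ 0) ≡ ⊥
  nothing<0 zero f = refl
  nothing<0 (suc n) f = cong (false ∷_) (nothing<0 n (λ x → f (suc x)))
V1mask≡⊤++⊥ (suc m) n = cong (true ∷_) (V1mask≡⊤++⊥ m n)

∣[p++q]∩[⊤++⊥]∣≡∣p∣ : ∀ {m n} (p : Subset m) (q : Subset n) → ∣ (p Vec.++ q) ∩ (⊤ {m} Vec.++ ⊥ {n}) ∣ ≡ ∣ p ∣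
∣[p++q]∩[⊤++⊥]∣≡∣p∣ [] q = q∩⊥ q
  where
  q∩⊥ : ∀ {n} (q : Subset n) → ∣ q ∩ ⊥ ∣ ≡ 0
  q∩⊥ [] = refl
  q∩⊥ (true ∷ q) = q∩⊥ q
  q∩⊥ (false ∷ q) = q∩⊥ q
∣[p++q]∩[⊤++⊥]∣≡∣p∣ (true ∷ p) q = cong suc (∣[p++q]∩[⊤++⊥]∣≡∣p∣ p q)
∣[p++q]∩[⊤++⊥]∣≡∣p∣ (false ∷ p) q = ∣[p++q]∩[⊤++⊥]∣≡∣p∣ p q


∣p++q∣≡∣p∣+∣q∣ : ∀ {m n} (p : Subset m) (q : Subset n) → ∣ p Vec.++ q ∣ ≡ ∣ p ∣ + ∣ q ∣
∣p++q∣≡∣p∣+∣q∣ [] q = refl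
∣p++q∣≡∣p∣+∣q∣ (true ∷ p) q = cong suc (∣p++q∣≡∣p∣+∣q∣ p q)
∣p++q∣≡∣p∣+∣q∣ (false ∷ p) q = ∣p++q∣≡∣p∣+∣q∣ p q

module Link {k m n} (H : SemibipartiteGraph (suc k) m n) where

  link : Fin m → Subset n → Bool
  link v q = edge H (⁅ v ⁆ Vec.++ q)

  link-size : ∀ v q → link v q ≡ true → ∣ q ∣ ≡ k
  link-size v q h = suc-injective (begin
    suc ∣ q ∣                ≡⟨ cong (_+ ∣ q ∣) (∣⁅x⁆∣≡1 v) ⟨
    ∣ ⁅ v ⁆ ∣ + ∣ q ∣        ≡⟨ ∣p++q∣≡∣p∣+∣q∣ ⁅ v ⁆ q ⟨
    ∣ ⁅ v ⁆ Vec.++ q ∣       ≡⟨ edge-size H _ h ⟩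
    suc k                    ∎)
    where open ≡-Reasoning

  degree≡countᵇ-link : ∀ v → degree H (v ↑ˡ n) ≡ countᵇ (link v) (allSubsets n)
  degree≡countᵇ-link v = begin
    degree H (v ↑ˡ n)
      ≡⟨ sum-map≡∑ _ (allSubsets (m + n)) ⟩
    ∑ (λ e → 𝟙 (edge H e ∧ lookup e (v ↑ˡ n))) (allSubsets (m + n))
      ≡⟨ ∑-allSubsets-++ m n _ ⟩
    ∑ (λ p → ∑ (λ q → 𝟙 (edge H (p Vec.++ q) ∧ lookup (p Vec.++ q) (v ↑ˡ n))) (allSubsets n)) (allSubsets m)
      ≡⟨ ∑-allSubsets-single m ⁅ v ⁆ _ (λ p p≢ → ∑-zero (allSubsets n) (no-edge p p≢)) ⟩
    ∑ (λ q → 𝟙 (edge H (⁅ v ⁆ Vec.++ q) ∧ lookup (⁅ v ⁆ Vec.++ q) (v ↑ˡ n))) (allSubsets n)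
      ≡⟨ ∑-cong (allSubsets n) (λ q → cong 𝟙 (trans (cong (link v q ∧_) (v∈⁅v⁆++ q)) (∧-identityʳ _))) ⟩
    countᵇ (link v) (allSubsets n) ∎
    where
    open ≡-Reasoning
    v∈⁅v⁆++ : ∀ q → lookup (⁅ v ⁆ Vec.++ q) (v ↑ˡ n) ≡ true
    v∈⁅v⁆++ q = trans (lookup-++ˡ ⁅ v ⁆ q v) (lookup-⁅x⁆-x v)
    no-edge : ∀ p → p ≢ ⁅ v ⁆ → ∀ q → 𝟙 (edge H (p Vec.++ q) ∧ lookup (p Vec.++ q) (v ↑ˡ n)) ≡ 0
    no-edge p p≢ q rewrite lookup-++ˡ p q v with lookup p v in pᵥ | edge H (p Vec.++ q) in e
    ... | false | b = cong 𝟙 (∧-zeroʳ b)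
    ... | true | false = refl
    ... | true | true = contradiction (∣∣≡1⇒≡⁅⁆ p pᵥ (begin
          ∣ p ∣                                 ≡⟨ ∣[p++q]∩[⊤++⊥]∣≡∣p∣ p q ⟨
          ∣ (p Vec.++ q) ∩ (⊤ {m} Vec.++ ⊥) ∣   ≡⟨ cong (λ r → ∣ (p Vec.++ q) ∩ r ∣) (V1mask≡⊤++⊥ m n) ⟨
          ∣ (p Vec.++ q) ∩ V1mask m n ∣         ≡⟨ edge-V1 H _ e ⟩
          1                                     ∎)) p≢

module Copies {k m n} (H : SemibipartiteGraph (suc k) m n) where
  open Link H

  unlinked : Subset m → Subset n → Bool
  unlinked B q = any (λ v → lookup B v ∧ not (link v q)) (allFin m)

  freshCommonLink : Subset m → Subset n → Subset n → Bool
  freshCommonLink B U q = not (unlinked B q) ∧ not (intersects q U)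

  ¬unlinked⇒link : ∀ B q {v} → unlinked B q ≡ false → lookup B v ≡ true → link v q ≡ true
  ¬unlinked⇒link B q {v} h Bᵥ with link v q in l
  ... | true = refl
  ... | false = contradiction (trans (sym (any≡false (λ w → lookup B w ∧ not (link w q)) (allFin m) (∈-allFin v) h))
                                     (cong₂ (λ a b → a ∧ not b) Bᵥ l)) λ ()

  freshCommonLink-size : ∀ {B} U q → 1 ≤ ∣ B ∣ → freshCommonLink B U q ≡ true → ∣ q ∣ ≡ k
  freshCommonLink-size {B} U q ∣B∣≥1 h =
    let v , Bᵥ = ∣∣≥1⇒lookup B ∣B∣≥1 in link-size v q (¬unlinked⇒link B q (Bool.not-injective (∧-conicalˡ _ _ h)) Bᵥ)

  parts : Subset m → (Fin k → Subset n) → Fin (suc k) → Subset (m + n)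
  parts B A zero = B Vec.++ ⊥
  parts B A (suc i) = ⊥ Vec.++ A i

  module FromBox (s : Fin (suc k) → ℕ) (r≥2 : 2 ≤ suc k) (B : Subset m) (U : Subset n) (∣B∣≡s₀ : ∣ B ∣ ≡ s zero)
                 (s-pos : ∀ i → 1 ≤ s (suc i))
                 (box : Box (λ xs → distinct xs ∧ freshCommonLink B U (entries xs)) (λ i → s (suc i))) where
    open Box box renaming (side to A; side-size to ∣A∣≡s; inside to box-inside)

    private
      element : ∀ l → Fin n
      element l = proj₁ (∣∣≥1⇒lookup (A l) (subst (1 ≤_) (sym (∣A∣≡s l)) (s-pos l)))

      through : Fin n → Vec (Fin n) k
      through y = tabulate (λ l → if lookup (A l) y then y else element l)

      through-inside : ∀ y l → lookup (A l) (lookup (through y) l) ≡ true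
      through-inside y l rewrite lookup∘tabulate (λ l → if lookup (A l) y then y else element l) l
        with lookup (A l) y in Aₗy
      ... | true = Aₗy
      ... | false = proj₂ (∣∣≥1⇒lookup (A l) (subst (1 ≤_) (sym (∣A∣≡s l)) (s-pos l)))

      through-hits : ∀ y l → lookup (A l) y ≡ true → lookup (through y) l ≡ y
      through-hits y l Aₗy rewrite lookup∘tabulate (λ l → if lookup (A l) y then y else element l) l | Aₗy = refl

      fresh : ∀ xs → (∀ l → lookup (A l) (lookup xs l) ≡ true) → freshCommonLink B U (entries xs) ≡ true
      fresh xs inA = ∧-conicalʳ (distinct xs) _ (box-inside xs inA)

    sides-disjoint : ∀ i j y → lookup (A i) y ≡ true → lookup (A j) y ≡ true → i ≡ j
    sides-disjoint i j y Aᵢy Aⱼy =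
      distinct-injective (through y) (∧-conicalˡ _ _ (box-inside (through y) (through-inside y)))
        (trans (through-hits y i Aᵢy) (sym (through-hits y j Aⱼy)))

    avoids-U : ∀ i y → lookup (A i) y ≡ true → lookup U y ≡ false
    avoids-U i y Aᵢy = ¬intersects⇒disjoint (entries (through y)) U
      (Bool.not-injective (∧-conicalʳ _ _ (fresh (through y) (through-inside y))))
      (subst (λ z → lookup (entries (through y)) z ≡ true) (through-hits y i Aᵢy) (lookup-entries (through y) i))

    parts-size : ∀ i → ∣ parts B A i ∣ ≡ s i
    parts-size zero = trans (∣p++q∣≡∣p∣+∣q∣ B ⊥) (trans (cong (∣ B ∣ +_) (∣⊥∣≡0 n)) (trans (+-identityʳ _) ∣B∣≡s₀))
    parts-size (suc i) = trans (∣p++q∣≡∣p∣+∣q∣ (⊥ {m}) (A i)) (trans (cong (_+ ∣ A i ∣) (∣⊥∣≡0 m)) (∣A∣≡s i))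

    parts-V1 : ∀ x → x ∈ parts B A zero → InV1 {m} {n} x
    parts-V1 x x∈ with lookup-++⊥ B x ([]=⇒lookup x∈)
    ... | v , refl , _ = subst (_< m) (sym (toℕ-↑ˡ v n)) (toℕ<n v)

    parts-V2 : ∀ i → i ≢ zero → ∀ x → x ∈ parts B A i → InV2 {m} {n} x
    parts-V2 zero i≢0 = contradiction refl i≢0
    parts-V2 (suc i) _ x x∈ with lookup-⊥++ (A i) x ([]=⇒lookup x∈)
    ... | y , refl , _ = ≤-trans (m≤m+n m (toℕ y)) (≤-reflexive (sym (toℕ-↑ʳ m y)))

    parts-disjoint : ∀ i j → i ≢ j → Empty (parts B A i ∩ parts B A j)
    parts-disjoint i j i≢j (x , x∈) with x∈p∩q⁻ (parts B A i) (parts B A j) x∈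
    parts-disjoint zero zero i≢j _ | _ = i≢j refl
    parts-disjoint zero (suc j) _ (x , _) | x∈B , x∈Aⱼ
      with lookup-++⊥ B x ([]=⇒lookup x∈B) | lookup-⊥++ (A j) x ([]=⇒lookup x∈Aⱼ)
    ... | v , refl , _ | y , eq , _ = ↑ˡ≢↑ʳ v y eq
    parts-disjoint (suc i) zero _ (x , _) | x∈Aᵢ , x∈B
      with lookup-++⊥ B x ([]=⇒lookup x∈B) | lookup-⊥++ (A i) x ([]=⇒lookup x∈Aᵢ)
    ... | v , refl , _ | y , eq , _ = ↑ˡ≢↑ʳ v y eq
    parts-disjoint (suc i) (suc j) i≢j (x , _) | x∈Aᵢ , x∈Aⱼ
      with lookup-⊥++ (A i) x ([]=⇒lookup x∈Aᵢ) | lookup-⊥++ (A j) x ([]=⇒lookup x∈Aⱼ)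
    ... | y , refl , Aᵢy | y′ , eq , Aⱼy′ rewrite ↑ʳ-injective m y y′ eq =
      i≢j (cong suc (sides-disjoint i j y′ Aᵢy Aⱼy′))

    module _ (f : Fin (suc k) → Fin (m + n)) (f∈ : ∀ i → f i ∈ parts B A i) where
      private
        v : Fin m
        v = proj₁ (lookup-++⊥ B (f zero) ([]=⇒lookup (f∈ zero)))
        y : Fin k → Fin n
        y i = proj₁ (lookup-⊥++ (A i) (f (suc i)) ([]=⇒lookup (f∈ (suc i))))
        xs : Vec (Fin n) k
        xs = tabulate y
        f₀≡v : f zero ≡ v ↑ˡ n
        f₀≡v = proj₁ (proj₂ (lookup-++⊥ B (f zero) ([]=⇒lookup (f∈ zero))))
        fᵢ≡yᵢ : ∀ i → f (suc i) ≡ m ↑ʳ y i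
        fᵢ≡yᵢ i = proj₁ (proj₂ (lookup-⊥++ (A i) (f (suc i)) ([]=⇒lookup (f∈ (suc i)))))
        xs-inside : ∀ i → lookup (A i) (lookup xs i) ≡ true
        xs-inside i = subst (λ z → lookup (A i) z ≡ true) (sym (lookup∘tabulate y i))
                            (proj₂ (proj₂ (lookup-⊥++ (A i) (f (suc i)) ([]=⇒lookup (f∈ (suc i))))))

      transversal-linked : link v (entries xs) ≡ true
      transversal-linked = ¬unlinked⇒link B (entries xs)
        (Bool.not-injective (∧-conicalˡ _ _ (fresh xs xs-inside)))
        (proj₂ (proj₂ (lookup-++⊥ B (f zero) ([]=⇒lookup (f∈ zero)))))

      transversal≡ : ∀ e → (∀ x → (x ∈ e) ⇔ (∃ λ i → f i ≡ x)) → e ≡ ⁅ v ⁆ Vec.++ entries xs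
      transversal≡ e e⇔ = ⊆-antisym e⊆ ⊆e
        where
        e⊆ : e ⊆ ⁅ v ⁆ Vec.++ entries xs
        e⊆ {x} x∈e with Equivalence.to (e⇔ x) x∈e
        ... | zero , refl = lookup⇒[]= _ _ (subst (λ z → lookup (⁅ v ⁆ Vec.++ entries xs) z ≡ true) (sym f₀≡v)
                              (trans (lookup-++ˡ ⁅ v ⁆ (entries xs) v) (lookup-⁅x⁆-x v)))
        ... | suc i , refl = lookup⇒[]= _ _ (subst (λ z → lookup (⁅ v ⁆ Vec.++ entries xs) z ≡ true) (sym (fᵢ≡yᵢ i))
                              (trans (lookup-++ʳ ⁅ v ⁆ (entries xs) (y i))
                                     (subst (λ z → lookup (entries xs) z ≡ true) (lookup∘tabulate y i) (lookup-entries xs i))))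
        ⊆e : ⁅ v ⁆ Vec.++ entries xs ⊆ e
        ⊆e {x} x∈ with split m n x
        ... | left w = Equivalence.from (e⇔ (w ↑ˡ n))
              (zero , trans f₀≡v (cong (_↑ˡ n) (lookup-⁅⁆⇒≡ v w (trans (sym (lookup-++ˡ ⁅ v ⁆ (entries xs) w)) ([]=⇒lookup x∈)))))
        ... | right z with ∈ᵛ⇒lookup z xs (trans (sym (lookup∘tabulate (_∈ᵛ xs) z))
                                                 (trans (sym (lookup-++ʳ ⁅ v ⁆ (entries xs) z)) ([]=⇒lookup x∈)))
        ...   | i , xsᵢ≡z = Equivalence.from (e⇔ (m ↑ʳ z))
                (suc i , trans (fᵢ≡yᵢ i) (cong (m ↑ʳ_) (trans (sym (lookup∘tabulate y i)) xsᵢ≡z)))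

      transversal-edge : ∀ e → (∀ x → (x ∈ e) ⇔ (∃ λ i → f i ≡ x)) → edge H e ≡ true
      transversal-edge e e⇔ = subst (λ e → edge H e ≡ true) (sym (transversal≡ e e⇔)) transversal-linked

    copy : OrderedCopy H s r≥2
    copy = record
      { part      = parts B A
      ; part-size = parts-size
      ; part-V1   = parts-V1
      ; part-V2   = parts-V2
      ; part-disj = parts-disjoint
      ; complete  = transversal-edge }

-- Dense common links

absorb-error-terms : ∀ t P a X h → 8 * suc t * P ≤ a + 4 * X + h → X ≤ t * P → h ≤ P → P ≤ a
absorb-error-terms t P a X h big X≤tP h≤P = ≤-trans (m≤m+n P (4 * t * P + 6 * P)) (+-cancelʳ-≤ (4 * t * P + P) _ _ (begin
  P + (4 * t * P + 6 * P) + (4 * t * P + P) ≡⟨ regroup₁ t P ⟩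
  8 * suc t * P                             ≤⟨ big ⟩
  a + 4 * X + h                             ≤⟨ +-mono-≤ (+-monoʳ-≤ a (*-monoʳ-≤ 4 X≤tP)) h≤P ⟩
  a + 4 * (t * P) + P                       ≡⟨ regroup₂ a t P ⟩
  a + (4 * t * P + P)                       ∎))
  where
  open ≤-Reasoning
  regroup₁ : ∀ t P → P + (4 * t * P + 6 * P) + (4 * t * P + P) ≡ 8 * suc t * P
  regroup₁ = solve-∀
  regroup₂ : ∀ a t P → a + 4 * (t * P) + P ≡ a + (4 * t * P + P)
  regroup₂ = solve-∀

module Density {k′ m n} (H : SemibipartiteGraph (suc (suc k′)) m n) (t₁ p d σ : ℕ) (L : Subset m)
  (degree-large : ∀ v → p * n ^ suc k′ ≤ countᵇ (Link.link H v) (allSubsets n) * d)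
  (L-almost-complete : ∀ w → lookup L w ≡ true →
     2 * suc t₁ * d * countᵇ (λ q → (∣ q ∣ ≡ᵇ suc k′) ∧ not (Link.link H w q)) (allSubsets n) ≤ p * n ^ suc k′)
  (m-small : 8 * σ * m * d ≤ p * n) (p≥1 : 1 ≤ p) where

  open Link H
  open Copies H
  open ≤-Reasoning

  k : ℕ
  k = suc k′
  s₁ : ℕ
  s₁ = suc t₁
  sets : List (Subset n)
  sets = allSubsets n

  kSet : Subset n → Bool
  kSet q = ∣ q ∣ ≡ᵇ k

  -- With α = p / d, the inequality d * x ≤ P says x ≤ α n^k.
  P : ℕ
  P = p * n ^ k

  #meeting : Subset n → ℕ
  #meeting U = countᵇ (λ q → kSet q ∧ intersects q U) sets

  link⇒kSet : ∀ v q → link v q ≡ true → kSet q ≡ true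
  link⇒kSet v q h = ≡⇒≡ᵇ≡true (link-size v q h)

  few-meeting : ∀ U → s₁ * ∣ U ∣ ≤ σ * m → 8 * s₁ * d * #meeting U ≤ P
  few-meeting U s₁U≤σm = begin
    8 * s₁ * d * #meeting U            ≤⟨ *-monoʳ-≤ (8 * s₁ * d) (≤-trans (count-intersecting n k′ U) (*-monoʳ-≤ ∣ U ∣ (C≤^ n k′))) ⟩
    8 * s₁ * d * (∣ U ∣ * n ^ k′)      ≡⟨ rearrange₁ s₁ d ∣ U ∣ (n ^ k′) ⟩
    8 * d * (s₁ * ∣ U ∣) * n ^ k′      ≤⟨ *-monoˡ-≤ (n ^ k′) (*-monoʳ-≤ (8 * d) s₁U≤σm) ⟩
    8 * d * (σ * m) * n ^ k′           ≡⟨ cong (_* n ^ k′) (rearrange₂ d σ m) ⟩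
    8 * σ * m * d * n ^ k′             ≤⟨ *-monoˡ-≤ (n ^ k′) m-small ⟩
    p * n * n ^ k′                     ≡⟨ *-assoc p n (n ^ k′) ⟩
    P                                  ∎
    where
    rearrange₁ : ∀ s d u x → 8 * s * d * (u * x) ≡ 8 * d * (s * u) * x
    rearrange₁ = solve-∀
    rearrange₂ : ∀ d σ m → 8 * d * (σ * m) ≡ 8 * σ * m * d
    rearrange₂ = solve-∀

  n^k≤P : n ^ k ≤ P
  n^k≤P = ≤-trans (≤-reflexive (sym (*-identityˡ (n ^ k)))) (*-monoˡ-≤ (n ^ k) p≥1)

  unlinkedIn : Subset m → Subset n → Bool
  unlinkedIn W q = any (λ v → lookup W v ∧ (kSet q ∧ not (link v q))) (allFin m)

  link-cover : ∀ u W U q → link u q ≡ true →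
               1 ≤ 𝟙 (freshCommonLink (⁅ u ⁆ ∪ W) U q) + 𝟙 (unlinkedIn W q) + 𝟙 (kSet q ∧ intersects q U)
  link-cover u W U q uq with intersects q U
  ... | true rewrite link⇒kSet u q uq = m≤n+m 1 _
  ... | false with unlinked (⁅ u ⁆ ∪ W) q in ul
  ...   | false = s≤s z≤n
  ...   | true with any≡true⇒∃ _ (allFin m) ul
  ...     | v , B∌v with ∨≡true (lookup ⁅ u ⁆ v) (lookup W v) (trans (sym (lookup-∪ ⁅ u ⁆ W v)) (∧-conicalˡ _ _ B∌v))
  ...       | inj₁ u≡v = contradiction (subst (λ w → link w q ≡ true) (lookup-⁅⁆⇒≡ u v u≡v) uq)
                                        (λ vq → contradiction (trans (sym (cong not vq)) (∧-conicalʳ _ _ B∌v)) λ ())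
  ...       | inj₂ Wv = ≤-trans (≤-reflexive (cong 𝟙 (sym (any≡true _ (allFin m) (∈-allFin v) W∌q))))
                                (m≤m+n (𝟙 (unlinkedIn W q)) _)
    where
    W∌q : lookup W v ∧ (kSet q ∧ not (link v q)) ≡ true
    W∌q rewrite Wv | link⇒kSet u q uq = ∧-conicalʳ _ _ B∌v

  #non-links : Fin m → ℕ
  #non-links v = countᵇ (λ q → kSet q ∧ not (link v q)) sets

  #non-links-in : Subset m → ℕ
  #non-links-in W = ∑ (λ v → 𝟙 (lookup W v) * #non-links v) (allFin m)

  #links≤ : ∀ u W U → countᵇ (link u) sets ≤ countᵇ (freshCommonLink (⁅ u ⁆ ∪ W) U) sets + #non-links-in W + #meeting U
  #links≤ u W U = begin
    countᵇ (link u) sets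
      ≤⟨ ∑-mono sets cover ⟩
    ∑ (λ q → 𝟙 (freshCommonLink (⁅ u ⁆ ∪ W) U q) + 𝟙 (unlinkedIn W q) + 𝟙 (kSet q ∧ intersects q U)) sets
      ≡⟨ trans (∑-+ _ _ sets) (cong (_+ #meeting U) (∑-+ _ _ sets)) ⟩
    fresh + countᵇ (unlinkedIn W) sets + #meeting U
      ≤⟨ +-monoˡ-≤ (#meeting U) (+-monoʳ-≤ fresh (countᵇ-any≤∑ _ (allFin m) sets)) ⟩
    fresh + ∑ (λ v → countᵇ (λ q → lookup W v ∧ (kSet q ∧ not (link v q))) sets) (allFin m) + #meeting U
      ≡⟨ cong (λ x → fresh + x + #meeting U) (∑-cong (allFin m) (λ v → countᵇ-const-∧ (lookup W v) _ sets)) ⟩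
    fresh + #non-links-in W + #meeting U ∎
    where
    fresh : ℕ
    fresh = countᵇ (freshCommonLink (⁅ u ⁆ ∪ W) U) sets
    cover : ∀ q → 𝟙 (link u q) ≤ 𝟙 (freshCommonLink (⁅ u ⁆ ∪ W) U q) + 𝟙 (unlinkedIn W q) + 𝟙 (kSet q ∧ intersects q U)
    cover q with link u q in uq
    ... | true = link-cover u W U q uq
    ... | false = z≤n

  few-non-links-in : ∀ W → W ⊆ᵇ L ≡ true → ∣ W ∣ ≡ t₁ → 2 * s₁ * d * #non-links-in W ≤ t₁ * P
  few-non-links-in W W⊆L ∣W∣≡t₁ = begin
    2 * s₁ * d * #non-links-in W                                  ≡⟨ ∑-*ˡ (2 * s₁ * d) _ (allFin m) ⟨
    ∑ (λ v → 2 * s₁ * d * (𝟙 (lookup W v) * #non-links v)) (allFin m) ≤⟨ ∑-mono (allFin m) per-vertex ⟩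
    ∑ (λ v → 𝟙 (lookup W v) * P) (allFin m)                       ≡⟨ ∑-𝟙* (lookup W) P (allFin m) ⟩
    countᵇ (lookup W) (allFin m) * P                                ≡⟨ cong (_* P) (trans (countᵇ-lookup≡∣∣ W) ∣W∣≡t₁) ⟩
    t₁ * P                                                          ∎
    where
    per-vertex : ∀ v → 2 * s₁ * d * (𝟙 (lookup W v) * #non-links v) ≤ 𝟙 (lookup W v) * P
    per-vertex v with lookup W v in Wv
    ... | true = ≤-trans (≤-reflexive (cong (2 * s₁ * d *_) (+-identityʳ _)))
                         (≤-trans (L-almost-complete v (⊆ᵇ-sound W L W⊆L Wv)) (≤-reflexive (sym (+-identityʳ P))))
    ... | false = ≤-reflexive (*-zeroʳ (2 * s₁ * d))

  dense-with-L : ∀ u W U → W ⊆ᵇ L ≡ true → ∣ W ∣ ≡ t₁ → s₁ * ∣ U ∣ ≤ σ * m →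
                 n ^ k ≤ 8 * s₁ * d * countᵇ (freshCommonLink (⁅ u ⁆ ∪ W) U) sets
  dense-with-L u W U W⊆L ∣W∣≡t₁ s₁U≤σm =
    ≤-trans n^k≤P (absorb-error-terms t₁ P (8 * s₁ * d * fresh) (2 * s₁ * d * X) (8 * s₁ * d * #meeting U)
                     big (few-non-links-in W W⊆L ∣W∣≡t₁) (few-meeting U s₁U≤σm))
    where
    fresh : ℕ
    fresh = countᵇ (freshCommonLink (⁅ u ⁆ ∪ W) U) sets
    X : ℕ
    X = #non-links-in W
    expand : ∀ s c x h d → 8 * s * ((c + x + h) * d) ≡ 8 * s * d * c + 4 * (2 * s * d * x) + 8 * s * d * h
    expand = solve-∀
    big : 8 * s₁ * P ≤ 8 * s₁ * d * fresh + 4 * (2 * s₁ * d * X) + 8 * s₁ * d * #meeting U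
    big = begin
      8 * s₁ * P                                ≤⟨ *-monoʳ-≤ (8 * s₁) (degree-large u) ⟩
      8 * s₁ * (countᵇ (link u) sets * d)       ≤⟨ *-monoʳ-≤ (8 * s₁) (*-monoˡ-≤ d (#links≤ u W U)) ⟩
      8 * s₁ * ((fresh + X + #meeting U) * d)   ≡⟨ expand s₁ fresh X (#meeting U) d ⟩
      8 * s₁ * d * fresh + 4 * (2 * s₁ * d * X) + 8 * s₁ * d * #meeting U ∎

  -- Each v ∈ X keeps half of its link after discarding the sets meeting U.  Double counting these
  -- pairs (v, q) shows that many k-sets q are fresh for at least s₁ vertices of X, hence covered by
  -- the fresh common link of an s₁-subset of X; averaging over these subsets gives the candidate.
  module OutsideL (t₁≥1 : 1 ≤ t₁) (X : Subset m) (U : Subset n) (T : ℕ) (∣X∣≡T : ∣ X ∣ ≡ T) (s₁≤T : s₁ ≤ T)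
                  (4t₁d≤Tp : 4 * t₁ * d ≤ T * p) (s₁U≤σm : s₁ * ∣ U ∣ ≤ σ * m) where

    freshLink : Fin m → Subset n → Bool
    freshLink v q = link v q ∧ not (intersects q U)

    many-fresh-links : ∀ v → P ≤ 2 * d * countᵇ (freshLink v) sets
    many-fresh-links v = *-cancelˡ-≤ 15 (≤-trans (+-cancelʳ-≤ P _ _ (begin
      15 * P + P                          ≡⟨ split16 P ⟩
      16 * P                              ≤⟨ *-monoʳ-≤ 16 (degree-large v) ⟩
      16 * (countᵇ (link v) sets * d)     ≡⟨ rearrange (countᵇ (link v) sets) d ⟩
      16 * d * countᵇ (link v) sets       ≤⟨ *-monoʳ-≤ (16 * d) links≤ ⟩
      16 * d * (fresh + #meeting U)       ≡⟨ *-distribˡ-+ (16 * d) fresh (#meeting U) ⟩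
      16 * d * fresh + 16 * d * #meeting U ≤⟨ +-monoʳ-≤ (16 * d * fresh) few ⟩
      16 * d * fresh + P                  ∎)) (≤-trans (m≤m+n _ (14 * d * fresh)) (≤-reflexive (split30 d fresh))))
      where
      fresh : ℕ
      fresh = countᵇ (freshLink v) sets
      links≤ : countᵇ (link v) sets ≤ fresh + #meeting U
      links≤ = ≤-trans (∑-mono sets cover) (≤-reflexive (∑-+ _ _ sets))
        where
        cover : ∀ q → 𝟙 (link v q) ≤ 𝟙 (freshLink v q) + 𝟙 (kSet q ∧ intersects q U)
        cover q with link v q in vq | intersects q U
        ... | false | _ = z≤n
        ... | true | false = s≤s z≤n
        ... | true | true rewrite link⇒kSet v q vq = s≤s z≤n
      few : 16 * d * #meeting U ≤ P
      few = ≤-trans (*-monoˡ-≤ (#meeting U) (*-monoˡ-≤ d (*-monoʳ-≤ 8 (s≤s t₁≥1)))) (few-meeting U s₁U≤σm)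
      split16 : ∀ P → 15 * P + P ≡ 16 * P
      split16 = solve-∀
      rearrange : ∀ c d → 16 * (c * d) ≡ 16 * d * c
      rearrange = solve-∀
      split30 : ∀ d f → 16 * d * f + 14 * d * f ≡ 15 * (2 * d * f)
      split30 = solve-∀

    #fresh-in-X : Subset n → ℕ
    #fresh-in-X q = countᵇ (λ v → lookup X v ∧ freshLink v q) (allFin m)

    many-fresh-pairs : T * P ≤ 2 * d * ∑ #fresh-in-X sets
    many-fresh-pairs = begin
      T * P                                                               ≡⟨ cong (_* P) (trans (sym ∣X∣≡T) (sym (countᵇ-lookup≡∣∣ X))) ⟩
      countᵇ (lookup X) (allFin m) * P                                    ≡⟨ ∑-𝟙* (lookup X) P (allFin m) ⟨
      ∑ (λ v → 𝟙 (lookup X v) * P) (allFin m)                             ≤⟨ ∑-mono (allFin m) (λ v → *-monoʳ-≤ (𝟙 (lookup X v)) (many-fresh-links v)) ⟩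
      ∑ (λ v → 𝟙 (lookup X v) * (2 * d * countᵇ (freshLink v) sets)) (allFin m)
        ≡⟨ trans (∑-cong (allFin m) (λ v → rearrange (𝟙 (lookup X v)) d _)) (∑-*ˡ (2 * d) _ (allFin m)) ⟩
      2 * d * ∑ (λ v → 𝟙 (lookup X v) * countᵇ (freshLink v) sets) (allFin m)
        ≡⟨ cong (2 * d *_) (trans (∑-cong (allFin m) (λ v → sym (∑-*ˡ (𝟙 (lookup X v)) _ sets)))
                                  (trans (∑-cong (allFin m) (λ v → ∑-cong sets (λ q → sym (𝟙-∧ (lookup X v) _))))
                                         (∑-swap (λ v q → 𝟙 (lookup X v ∧ freshLink v q)) (allFin m) sets))) ⟩
      2 * d * ∑ #fresh-in-X sets ∎
      where
      rearrange : ∀ a d c → a * (2 * d * c) ≡ 2 * d * (a * c)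
      rearrange = solve-∀

    candidate : Subset m → Bool
    candidate c = (∣ c ∣ ≡ᵇ s₁) ∧ (c ⊆ᵇ X)

    covered : Subset n → Bool
    covered q = any (λ c → candidate c ∧ freshCommonLink c U q) (allSubsets m)

    #fresh-in-X≤T : ∀ q → #fresh-in-X q ≤ T
    #fresh-in-X≤T q = ≤-trans (countᵇ-mono (allFin m) (λ v h → ∧-conicalˡ _ _ h))
                              (≤-reflexive (trans (countᵇ-lookup≡∣∣ X) ∣X∣≡T))

    #fresh-in-X≡0 : ∀ q → kSet q ≡ false → #fresh-in-X q ≡ 0
    #fresh-in-X≡0 q ¬kSet = ∑-zero (allFin m) no-link
      where
      no-link : ∀ v → 𝟙 (lookup X v ∧ freshLink v q) ≡ 0
      no-link v with link v q in vq
      ... | false = cong 𝟙 (∧-zeroʳ (lookup X v))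
      ... | true = contradiction (trans (sym ¬kSet) (link⇒kSet v q vq)) λ ()

    s₁-fresh⇒covered : ∀ q → s₁ ≤ #fresh-in-X q → covered q ≡ true
    s₁-fresh⇒covered q s₁≤ = any≡true _ (allSubsets m) (∈-allSubsets m c) (∧-≡true candidate-c fresh-c)
      where
      Z : Subset m
      Z = tabulate (λ v → lookup X v ∧ freshLink v q)
      chosen : Σ (Subset m) λ c → c ⊆ᵇ Z ≡ true × ∣ c ∣ ≡ s₁
      chosen = ∃-⊆ᵇ-ofSize Z s₁ (≤-trans s₁≤ (≤-reflexive (sym (∣tabulate∣≡countᵇ m (λ v → v) _))))
      c : Subset m
      c = proj₁ chosen
      ∣c∣≡s₁ : ∣ c ∣ ≡ s₁
      ∣c∣≡s₁ = proj₂ (proj₂ chosen)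
      c⊆Z : ∀ v → lookup c v ≡ true → lookup X v ∧ freshLink v q ≡ true
      c⊆Z v cᵥ = trans (sym (lookup∘tabulate (λ v → lookup X v ∧ freshLink v q) v)) (⊆ᵇ-sound c Z (proj₁ (proj₂ chosen)) cᵥ)
      candidate-c : candidate c ≡ true
      candidate-c = ∧-≡true (≡⇒≡ᵇ≡true ∣c∣≡s₁) (⊆ᵇ-complete c X (λ v cᵥ → ∧-conicalˡ _ _ (c⊆Z v cᵥ)))
      ¬unlinked : unlinked c q ≡ false
      ¬unlinked with unlinked c q in ul
      ... | false = refl
      ... | true with any≡true⇒∃ _ (allFin m) ul
      ...   | v , c∌v = contradiction (∧-conicalˡ (link v q) _ (∧-conicalʳ (lookup X v) _ (c⊆Z v (∧-conicalˡ (lookup c v) _ c∌v))))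
                                      (λ vq → contradiction (trans (sym (cong not vq)) (∧-conicalʳ (lookup c v) _ c∌v)) λ ())
      fresh-c : freshCommonLink c U q ≡ true
      fresh-c with ∣∣≥1⇒lookup c (≤-trans (s≤s z≤n) (≤-reflexive (sym ∣c∣≡s₁)))
      ... | v , cᵥ rewrite ¬unlinked = ∧-conicalʳ (link v q) _ (∧-conicalʳ (lookup X v) _ (c⊆Z v cᵥ))

    #fresh-in-X-bound : ∀ q → #fresh-in-X q ≤ T * 𝟙 (covered q) + t₁ * 𝟙 (kSet q)
    #fresh-in-X-bound q with covered q in cov
    ... | true = ≤-trans (#fresh-in-X≤T q) (≤-trans (≤-reflexive (sym (*-identityʳ T))) (m≤m+n _ _))
    ... | false with #fresh-in-X q ≤? t₁
    ...   | no t₁< = contradiction (trans (sym (s₁-fresh⇒covered q (≰⇒> t₁<))) cov) λ ()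
    ...   | yes ≤t₁ with kSet q in kq
    ...     | true = ≤-trans ≤t₁ (≤-trans (≤-reflexive (sym (*-identityʳ t₁))) (m≤n+m _ _))
    ...     | false = ≤-reflexive (trans (#fresh-in-X≡0 q kq) (sym (cong₂ _+_ (*-zeroʳ T) (*-zeroʳ t₁))))

    many-covered : P ≤ 4 * d * countᵇ covered sets
    many-covered = *-cancelˡ-≤ T {{>-nonZero (≤-trans (s≤s z≤n) s₁≤T)}} (+-cancelʳ-≤ (T * P) _ _ (begin
      T * P + T * P                                    ≡⟨ double (T * P) ⟩
      2 * (T * P)                                      ≤⟨ *-monoʳ-≤ 2 many-fresh-pairs ⟩
      2 * (2 * d * ∑ #fresh-in-X sets)                 ≡⟨ quadruple d _ ⟩
      4 * d * ∑ #fresh-in-X sets                       ≤⟨ *-monoʳ-≤ (4 * d) ∑-bound ⟩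
      4 * d * (T * #covered + t₁ * n ^ k)              ≡⟨ expand d T #covered t₁ (n ^ k) ⟩
      T * (4 * d * #covered) + 4 * t₁ * d * n ^ k      ≤⟨ +-monoʳ-≤ (T * (4 * d * #covered))
                                                            (≤-trans (*-monoˡ-≤ (n ^ k) 4t₁d≤Tp) (≤-reflexive (*-assoc T p (n ^ k)))) ⟩
      T * (4 * d * #covered) + T * P                   ∎))
      where
      #covered : ℕ
      #covered = countᵇ covered sets
      ∑-bound : ∑ #fresh-in-X sets ≤ T * #covered + t₁ * n ^ k
      ∑-bound = begin
        ∑ #fresh-in-X sets                                    ≤⟨ ∑-mono sets #fresh-in-X-bound ⟩
        ∑ (λ q → T * 𝟙 (covered q) + t₁ * 𝟙 (kSet q)) sets   ≡⟨ trans (∑-+ _ _ sets) (cong₂ _+_ (∑-*ˡ T _ sets) (∑-*ˡ t₁ _ sets)) ⟩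
        T * #covered + t₁ * countᵇ kSet sets                  ≤⟨ +-monoʳ-≤ (T * #covered) (*-monoʳ-≤ t₁
                                                                   (≤-trans (≤-reflexive (count-ofSize n k)) (C≤^ n k))) ⟩
        T * #covered + t₁ * n ^ k                             ∎
      double : ∀ x → x + x ≡ 2 * x
      double = solve-∀
      quadruple : ∀ d s → 2 * (2 * d * s) ≡ 4 * d * s
      quadruple = solve-∀
      expand : ∀ d T c t N → 4 * d * (T * c + t * N) ≡ T * (4 * d * c) + 4 * t * d * N
      expand = solve-∀

    #candidates≡ : countᵇ candidate (allSubsets m) ≡ T C s₁
    #candidates≡ = trans (count-⊆ᵇ-ofSize m X s₁) (cong (_C s₁) ∣X∣≡T)

    dense-outside-L : Σ (Subset m) λ c → candidate c ≡ true × n ^ k ≤ 4 * d * (T C s₁) * countᵇ (freshCommonLink c U) (allSubsets n)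
    dense-outside-L with average≤max candidate (λ c → countᵇ (freshCommonLink c U) sets) (allSubsets m)
                           (≤-trans (C-pos s₁≤T) (≤-reflexive (sym #candidates≡)))
    ... | c , candidate-c , average≤ = c , candidate-c , (begin
      n ^ k                                                   ≤⟨ n^k≤P ⟩
      P                                                       ≤⟨ many-covered ⟩
      4 * d * countᵇ covered sets                             ≤⟨ *-monoʳ-≤ (4 * d) union ⟩
      4 * d * ∑ (λ c → 𝟙 (candidate c) * fresh c) (allSubsets m) ≤⟨ *-monoʳ-≤ (4 * d) average≤ ⟩
      4 * d * (countᵇ candidate (allSubsets m) * fresh c)     ≡⟨ cong (λ x → 4 * d * (x * fresh c)) #candidates≡ ⟩
      4 * d * ((T C s₁) * fresh c)                            ≡⟨ *-assoc (4 * d) (T C s₁) (fresh c) ⟨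
      4 * d * (T C s₁) * fresh c                              ∎)
      where
      fresh : Subset m → ℕ
      fresh c = countᵇ (freshCommonLink c U) sets
      union : countᵇ covered sets ≤ ∑ (λ c → 𝟙 (candidate c) * fresh c) (allSubsets m)
      union = ≤-trans (countᵇ-any≤∑ (λ c q → candidate c ∧ freshCommonLink c U q) (allSubsets m) sets)
                      (≤-reflexive (∑-cong (allSubsets m) λ c → countᵇ-const-∧ (candidate c) (freshCommonLink c U) sets))

-- The greedy packing

balance-after-removal : ∀ t a a′ b b′ → t * (b′ + b) ≤ a′ + a → a + b ≡ suc t → 1 ≤ b → t * b′ ≤ a′
balance-after-removal t a a′ b b′ bal a+b≡1+t b≥1 = +-cancelʳ-≤ (suc t) _ _ (begin
  t * b′ + suc t          ≤⟨ +-monoʳ-≤ (t * b′) (≤-trans (≤-reflexive (sym (*-identityʳ (suc t)))) (*-monoʳ-≤ (suc t) b≥1)) ⟩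
  t * b′ + suc t * b      ≡⟨ regroup t b′ b ⟨
  t * (b′ + b) + b        ≤⟨ +-monoˡ-≤ b bal ⟩
  a′ + a + b              ≡⟨ +-assoc a′ a b ⟩
  a′ + (a + b)            ≡⟨ cong (a′ +_) a+b≡1+t ⟩
  a′ + suc t              ∎)
  where
  open ≤-Reasoning
  regroup : ∀ t b′ b → t * (b′ + b) + b ≡ t * b′ + suc t * b
  regroup = solve-∀

module Greedy {k′ m n} (H : SemibipartiteGraph (suc (suc k′)) m n) (s : Fin (suc (suc k′)) → ℕ)
  (t₁ : ℕ) (s₀≡1+t₁ : s zero ≡ suc t₁) (t₁≥1 : 1 ≤ t₁) (s-pos : ∀ i → 1 ≤ s (suc i))
  (p d σ T : ℕ) (σ≡ : ∑ (λ i → s (suc i)) (allFin (suc k′)) ≡ σ) (L : Subset m) (p≥1 : 1 ≤ p)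
  (degree-large : ∀ v → p * n ^ suc k′ ≤ countᵇ (Link.link H v) (allSubsets n) * d)
  (L-almost-complete : ∀ w → lookup L w ≡ true →
     2 * suc t₁ * d * countᵇ (λ q → (∣ q ∣ ≡ᵇ suc k′) ∧ not (Link.link H w q)) (allSubsets n) ≤ p * n ^ suc k′)
  (m-small : 8 * σ * m * d ≤ p * n) (4t₁d≤Tp : 4 * t₁ * d ≤ T * p) (1+t₁≤T : suc t₁ ≤ T)
  (boxes : ∀ G → n ^ suc k′ ≤ 8 * suc t₁ * d * (T C suc t₁) * countᵇ G (allTuples n (suc k′)) →
                Box G (λ i → s (suc i))) where

  open Link H
  open Copies H
  open Density H t₁ p d σ L degree-large L-almost-complete m-small p≥1
  open ≤-Reasoning

  D : ℕ
  D = 8 * s₁ * d * (T C s₁)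

  -- A step is possible as long as either every vertex can be completed by t₁ vertices of L,
  -- or there are T vertices outside L on which the averaging of OutsideL applies.
  balanced : Subset m → Set
  balanced R = t₁ * ∣ R ─ L ∣ ≤ ∣ R ∩ L ∣ ⊎ t₁ * T ≤ ∣ R ∩ L ∣

  record Step (R : Subset m) (U : Subset n) : Set where
    field
      B             : Subset m
      B⊆R           : B ⊆ᵇ R ≡ true
      ∣B∣≡s₁        : ∣ B ∣ ≡ s₁
      dense         : n ^ k ≤ D * countᵇ (freshCommonLink B U) sets
      balanced-rest : balanced (R ─ B)

  step-outside-L : ∀ R U → T ≤ ∣ R ─ L ∣ → balanced R → s₁ * ∣ U ∣ ≤ σ * m → Step R U
  step-outside-L R U T≤ bal s₁U≤σm = record
    { B = c ; B⊆R = c⊆R ; ∣B∣≡s₁ = ≡ᵇ≡true⇒≡ (∧-conicalˡ _ _ candidate-c)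
    ; dense = ≤-trans dense-c (*-monoˡ-≤ (countᵇ (freshCommonLink c U) sets) 4d≤8s₁d)
    ; balanced-rest = [ (λ h → inj₁ (≤-trans (*-monoʳ-≤ t₁ ∣[R─c]─L∣≤) (≤-trans h (≤-reflexive (sym ∣[R─c]∩L∣≡))))) ,
                        (λ h → inj₂ (≤-trans h (≤-reflexive (sym ∣[R─c]∩L∣≡)))) ]′ bal }
    where
    chosen : Σ (Subset m) λ X → X ⊆ᵇ (R ─ L) ≡ true × ∣ X ∣ ≡ T
    chosen = ∃-⊆ᵇ-ofSize (R ─ L) T T≤
    X : Subset m
    X = proj₁ chosen
    open OutsideL t₁≥1 X U T (proj₂ (proj₂ chosen)) 1+t₁≤T 4t₁d≤Tp s₁U≤σm using (candidate; dense-outside-L)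
    c : Subset m
    c = proj₁ dense-outside-L
    candidate-c : candidate c ≡ true
    candidate-c = proj₁ (proj₂ dense-outside-L)
    dense-c : n ^ k ≤ 4 * d * (T C s₁) * countᵇ (freshCommonLink c U) sets
    dense-c = proj₂ (proj₂ dense-outside-L)
    4d≤8s₁d : 4 * d * (T C s₁) ≤ D
    4d≤8s₁d = *-monoˡ-≤ (T C s₁) (*-monoˡ-≤ d (≤-trans (m≤m+n 4 4) (*-monoʳ-≤ 8 (s≤s (z≤n {t₁})))))
    c⊆R─L : ∀ v → lookup c v ≡ true → lookup (R ─ L) v ≡ true
    c⊆R─L v cᵥ = ⊆ᵇ-sound X (R ─ L) (proj₁ (proj₂ chosen)) (⊆ᵇ-sound c X (∧-conicalʳ _ _ candidate-c) cᵥ)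
    c⊆R : c ⊆ᵇ R ≡ true
    c⊆R = ⊆ᵇ-complete c R (λ v cᵥ → ∧-conicalˡ _ _ (trans (sym (lookup-─ R L v)) (c⊆R─L v cᵥ)))
    ∣c∩L∣≡0 : ∣ c ∩ L ∣ ≡ 0
    ∣c∩L∣≡0 = all-false⇒∣∣≡0 (c ∩ L) outside
      where
      outside : ∀ v → lookup (c ∩ L) v ≡ false
      outside v rewrite lookup-∩ c L v with lookup c v in cᵥ
      ... | false = refl
      ... | true = Bool.not-injective (∧-conicalʳ (lookup R v) _ (trans (sym (lookup-─ R L v)) (c⊆R─L v cᵥ)))
    ∣[R─c]∩L∣≡ : ∣ (R ─ c) ∩ L ∣ ≡ ∣ R ∩ L ∣
    ∣[R─c]∩L∣≡ = trans (sym (+-identityʳ _)) (trans (cong (∣ (R ─ c) ∩ L ∣ +_) (sym ∣c∩L∣≡0)) (∣[p─q]∩r∣+∣q∩r∣≡∣p∩r∣ R c L c⊆R))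
    ∣[R─c]─L∣≤ : ∣ (R ─ c) ─ L ∣ ≤ ∣ R ─ L ∣
    ∣[R─c]─L∣≤ = ≤-trans (m≤m+n _ _) (≤-reflexive (∣[p─q]─r∣+∣q─r∣≡∣p─r∣ R c L c⊆R))

  module WithL (R : Subset m) (U : Subset n) (u : Fin m) (Rᵤ : lookup R u ≡ true) (W : Subset m)
               (W⊆ : W ⊆ᵇ ((R ∩ L) - u) ≡ true) (∣W∣≡t₁ : ∣ W ∣ ≡ t₁) (s₁U≤σm : s₁ * ∣ U ∣ ≤ σ * m) where

    B : Subset m
    B = ⁅ u ⁆ ∪ W

    W-inside : ∀ v → lookup W v ≡ true → (lookup R v ∧ lookup L v) ∧ not (does (u Fin.≟ v)) ≡ true
    W-inside v Wᵥ = trans (sym (trans (lookup-─ (R ∩ L) ⁅ u ⁆ v) (cong₂ (λ a b → a ∧ not b) (lookup-∩ R L v) (lookup-⁅⁆ u v))))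
                          (⊆ᵇ-sound W _ W⊆ Wᵥ)

    u∉W : lookup W u ≡ false
    u∉W with lookup W u in Wᵤ
    ... | false = refl
    ... | true = contradiction (trans (sym (cong not (dec-true (u Fin.≟ u) refl))) (∧-conicalʳ _ _ (W-inside u Wᵤ))) λ ()

    u∈B : lookup B u ≡ true
    u∈B = trans (lookup-∪ ⁅ u ⁆ W u) (cong (_∨ lookup W u) (lookup-⁅x⁆-x u))

    ∣B∣≡s₁ : ∣ B ∣ ≡ s₁
    ∣B∣≡s₁ = trans (∣⁅x⁆∪p∣≡1+∣p∣ u W u∉W) (cong suc ∣W∣≡t₁)

    B⊆R : B ⊆ᵇ R ≡ true
    B⊆R = ⊆ᵇ-complete B R inside
      where
      inside : ∀ v → lookup B v ≡ true → lookup R v ≡ true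
      inside v Bᵥ with ∨≡true (lookup ⁅ u ⁆ v) (lookup W v) (trans (sym (lookup-∪ ⁅ u ⁆ W v)) Bᵥ)
      ... | inj₁ u≡v = subst (λ w → lookup R w ≡ true) (lookup-⁅⁆⇒≡ u v u≡v) Rᵤ
      ... | inj₂ Wᵥ = ∧-conicalˡ _ _ (∧-conicalˡ _ _ (W-inside v Wᵥ))

    dense : n ^ k ≤ D * countᵇ (freshCommonLink B U) sets
    dense = ≤-trans (dense-with-L u W U W⊆L ∣W∣≡t₁ s₁U≤σm)
                    (*-monoˡ-≤ (countᵇ (freshCommonLink B U) sets)
                               (≤-trans (≤-reflexive (sym (*-identityʳ (8 * s₁ * d)))) (*-monoʳ-≤ (8 * s₁ * d) (C-pos 1+t₁≤T))))
      where
      W⊆L : W ⊆ᵇ L ≡ true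
      W⊆L = ⊆ᵇ-complete W L (λ v Wᵥ → ∧-conicalʳ (lookup R v) _ (∧-conicalˡ _ _ (W-inside v Wᵥ)))

    ∣[R─B]∩L∣+∣B∩L∣≡ : ∣ (R ─ B) ∩ L ∣ + ∣ B ∩ L ∣ ≡ ∣ R ∩ L ∣
    ∣[R─B]∩L∣+∣B∩L∣≡ = ∣[p─q]∩r∣+∣q∩r∣≡∣p∩r∣ R B L B⊆R

    ∣[R─B]─L∣+∣B─L∣≡ : ∣ (R ─ B) ─ L ∣ + ∣ B ─ L ∣ ≡ ∣ R ─ L ∣
    ∣[R─B]─L∣+∣B─L∣≡ = ∣[p─q]─r∣+∣q─r∣≡∣p─r∣ R B L B⊆R

    ∣B∩L∣+∣B─L∣≡s₁ : ∣ B ∩ L ∣ + ∣ B ─ L ∣ ≡ s₁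
    ∣B∩L∣+∣B─L∣≡s₁ = trans (∣p∩q∣+∣p─q∣≡∣p∣ B L) ∣B∣≡s₁

    step : t₁ * ∣ (R ─ B) ─ L ∣ ≤ ∣ (R ─ B) ∩ L ∣ → Step R U
    step bal = record { B = B ; B⊆R = B⊆R ; ∣B∣≡s₁ = ∣B∣≡s₁ ; dense = dense ; balanced-rest = inj₁ bal }

  step-some-outside-L : ∀ R U → ¬ T ≤ ∣ R ─ L ∣ → 1 ≤ ∣ R ─ L ∣ → balanced R → s₁ * ∣ U ∣ ≤ σ * m → Step R U
  step-some-outside-L R U T≰ some-outside bal s₁U≤σm = M.step (balance-after-removal t₁ (∣ M.B ∩ L ∣) _ (∣ M.B ─ L ∣) _
                                       (subst₂ _≤_ (cong (t₁ *_) (sym M.∣[R─B]─L∣+∣B─L∣≡)) (sym M.∣[R─B]∩L∣+∣B∩L∣≡) t₁b≤a)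
                                       M.∣B∩L∣+∣B─L∣≡s₁ u∈B─L)
    where
    outside : ∃ λ u → lookup (R ─ L) u ≡ true
    outside = ∣∣≥1⇒lookup (R ─ L) some-outside
    u : Fin m
    u = proj₁ outside
    R─Lᵤ : lookup R u ∧ not (lookup L u) ≡ true
    R─Lᵤ = trans (sym (lookup-─ R L u)) (proj₂ outside)
    Lᵤ : lookup L u ≡ false
    Lᵤ = Bool.not-injective (∧-conicalʳ _ _ R─Lᵤ)
    t₁b≤a : t₁ * ∣ R ─ L ∣ ≤ ∣ R ∩ L ∣
    t₁b≤a = [ (λ h → h) , (λ h → ≤-trans (*-monoʳ-≤ t₁ (<⇒≤ (≰⇒> T≰))) h) ]′ bal
    t₁≤∣[R∩L]-u∣ : t₁ ≤ ∣ (R ∩ L) - u ∣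
    t₁≤∣[R∩L]-u∣ = begin
      t₁                     ≤⟨ ≤-trans (≤-reflexive (sym (*-identityʳ t₁))) (*-monoʳ-≤ t₁ some-outside) ⟩
      t₁ * ∣ R ─ L ∣         ≤⟨ t₁b≤a ⟩
      ∣ R ∩ L ∣              ≡⟨ ∣p-x∣+𝟙≡∣p∣ (R ∩ L) u ⟨
      ∣ (R ∩ L) - u ∣ + 𝟙 (lookup (R ∩ L) u) ≡⟨ cong (λ b → ∣ (R ∩ L) - u ∣ + 𝟙 b) (trans (lookup-∩ R L u) (trans (cong (lookup R u ∧_) Lᵤ) (∧-zeroʳ _))) ⟩
      ∣ (R ∩ L) - u ∣ + 0    ≡⟨ +-identityʳ _ ⟩
      ∣ (R ∩ L) - u ∣        ∎
    chosen : Σ (Subset m) λ W → W ⊆ᵇ ((R ∩ L) - u) ≡ true × ∣ W ∣ ≡ t₁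
    chosen = ∃-⊆ᵇ-ofSize ((R ∩ L) - u) t₁ t₁≤∣[R∩L]-u∣
    module M = WithL R U u (∧-conicalˡ _ _ R─Lᵤ) (proj₁ chosen) (proj₁ (proj₂ chosen)) (proj₂ (proj₂ chosen)) s₁U≤σm
    u∈B─L : 1 ≤ ∣ M.B ─ L ∣
    u∈B─L = lookup⇒∣∣≥1 (M.B ─ L) (trans (lookup-─ M.B L u) (cong₂ (λ a b → a ∧ not b) M.u∈B Lᵤ))

  step-inside-L : ∀ j R U → suc j * s₁ ≤ ∣ R ∣ → ¬ 1 ≤ ∣ R ─ L ∣ → s₁ * ∣ U ∣ ≤ σ * m → Step R U
  step-inside-L j R U s₁≤∣R∣ none-outside s₁U≤σm = M.step (≤-trans (≤-reflexive (trans (cong (t₁ *_) ∣[R─B]─L∣≡0) (*-zeroʳ t₁))) z≤n)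
    where
    ∣R─L∣≡0 : ∣ R ─ L ∣ ≡ 0
    ∣R─L∣≡0 = n<1⇒n≡0 (≰⇒> none-outside)
    ∣R∩L∣≡∣R∣ : ∣ R ∩ L ∣ ≡ ∣ R ∣
    ∣R∩L∣≡∣R∣ = trans (sym (+-identityʳ _)) (trans (cong (∣ R ∩ L ∣ +_) (sym ∣R─L∣≡0)) (∣p∩q∣+∣p─q∣≡∣p∣ R L))
    s₁≤∣R∩L∣ : s₁ ≤ ∣ R ∩ L ∣
    s₁≤∣R∩L∣ = ≤-trans (m≤m+n s₁ (j * s₁)) (≤-trans s₁≤∣R∣ (≤-reflexive (sym ∣R∩L∣≡∣R∣)))
    inside : ∃ λ u → lookup (R ∩ L) u ≡ true
    inside = ∣∣≥1⇒lookup (R ∩ L) (≤-trans (s≤s z≤n) s₁≤∣R∩L∣)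
    u : Fin m
    u = proj₁ inside
    t₁≤∣[R∩L]-u∣ : t₁ ≤ ∣ (R ∩ L) - u ∣
    t₁≤∣[R∩L]-u∣ = ≤-pred (≤-trans s₁≤∣R∩L∣ (≤-reflexive (trans (sym (∣p-x∣+𝟙≡∣p∣ (R ∩ L) u))
                                                                 (trans (cong (λ b → ∣ (R ∩ L) - u ∣ + 𝟙 b) (proj₂ inside)) (+-comm _ 1)))))
    chosen : Σ (Subset m) λ W → W ⊆ᵇ ((R ∩ L) - u) ≡ true × ∣ W ∣ ≡ t₁
    chosen = ∃-⊆ᵇ-ofSize ((R ∩ L) - u) t₁ t₁≤∣[R∩L]-u∣
    module M = WithL R U u (∧-conicalˡ _ _ (trans (sym (lookup-∩ R L u)) (proj₂ inside)))
                     (proj₁ chosen) (proj₁ (proj₂ chosen)) (proj₂ (proj₂ chosen)) s₁U≤σm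
    ∣[R─B]─L∣≡0 : ∣ (R ─ M.B) ─ L ∣ ≡ 0
    ∣[R─B]─L∣≡0 = n≤0⇒n≡0 (≤-trans (m≤m+n _ _) (≤-reflexive (trans M.∣[R─B]─L∣+∣B─L∣≡ ∣R─L∣≡0)))

  step : ∀ j R U → suc j * s₁ ≤ ∣ R ∣ → balanced R → s₁ * ∣ U ∣ ≤ σ * m → Step R U
  step j R U s₁≤∣R∣ bal s₁U≤σm with T ≤? ∣ R ─ L ∣ | 1 ≤? ∣ R ─ L ∣
  ... | yes T≤ | _ = step-outside-L R U T≤ bal s₁U≤σm
  ... | no T≰ | yes some-outside = step-some-outside-L R U T≰ some-outside bal s₁U≤σm
  ... | no _ | no none-outside = step-inside-L j R U s₁≤∣R∣ none-outside s₁U≤σm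

  r≥2 : 2 ≤ suc (suc k′)
  r≥2 = s≤s (s≤s z≤n)

  record Packing (R : Subset m) (U : Subset n) (j : ℕ) : Set where
    field
      copies     : Fin j → OrderedCopy H s r≥2
      disjoint   : ∀ a b → a ≢ b → ∀ i i′ → Empty (part (copies a) i ∩ part (copies b) i′)
      V1-in-R    : ∀ a x → lookup (part (copies a) zero) x ≡ true → ∃ λ v → x ≡ v ↑ˡ n × lookup R v ≡ true
      V2-avoid-U : ∀ a i x → lookup (part (copies a) (suc i)) x ≡ true → ∃ λ y → x ≡ m ↑ʳ y × lookup U y ≡ false

  parts-disjoint-from : ∀ B (A : Fin k → Subset n) R U (Q : Fin (suc k) → Subset (m + n)) →
    (∀ v → lookup B v ≡ true → lookup R v ≡ false) → (∀ i y → lookup (A i) y ≡ true → lookup U y ≡ true) →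
    (∀ x → lookup (Q zero) x ≡ true → ∃ λ v → x ≡ v ↑ˡ n × lookup R v ≡ true) →
    (∀ i x → lookup (Q (suc i)) x ≡ true → ∃ λ y → x ≡ m ↑ʳ y × lookup U y ≡ false) →
    ∀ i i′ → Empty (parts B A i ∩ Q i′)
  parts-disjoint-from B A R U Q B∩R≡∅ A⊆U Q₀⊆R Qᵢ∩U≡∅ i i′ (x , x∈) with x∈p∩q⁻ (parts B A i) (Q i′) x∈
  parts-disjoint-from B A R U Q B∩R≡∅ A⊆U Q₀⊆R Qᵢ∩U≡∅ zero zero (x , _) | x∈B , x∈Q
    with lookup-++⊥ B x ([]=⇒lookup x∈B) | Q₀⊆R x ([]=⇒lookup x∈Q)
  ... | v , refl , Bᵥ | v′ , eq , Rᵥ′ rewrite ↑ˡ-injective n v v′ eq = contradiction (trans (sym (B∩R≡∅ v′ Bᵥ)) Rᵥ′) λ ()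
  parts-disjoint-from B A R U Q B∩R≡∅ A⊆U Q₀⊆R Qᵢ∩U≡∅ zero (suc i′) (x , _) | x∈B , x∈Q
    with lookup-++⊥ B x ([]=⇒lookup x∈B) | Qᵢ∩U≡∅ i′ x ([]=⇒lookup x∈Q)
  ... | v , refl , _ | y , eq , _ = ↑ˡ≢↑ʳ v y eq
  parts-disjoint-from B A R U Q B∩R≡∅ A⊆U Q₀⊆R Qᵢ∩U≡∅ (suc i) zero (x , _) | x∈A , x∈Q
    with lookup-⊥++ (A i) x ([]=⇒lookup x∈A) | Q₀⊆R x ([]=⇒lookup x∈Q)
  ... | y , refl , _ | v , eq , _ = ↑ˡ≢↑ʳ v y (sym eq)
  parts-disjoint-from B A R U Q B∩R≡∅ A⊆U Q₀⊆R Qᵢ∩U≡∅ (suc i) (suc i′) (x , _) | x∈A , x∈Q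
    with lookup-⊥++ (A i) x ([]=⇒lookup x∈A) | Qᵢ∩U≡∅ i′ x ([]=⇒lookup x∈Q)
  ... | y , refl , Aᵢy | y′ , eq , Uy′ rewrite ↑ʳ-injective m y y′ eq = contradiction (trans (sym (A⊆U i y′ Aᵢy)) Uy′) λ ()

  module Extend {R U} (st : Step R U) where
    open Step st

    box : Box (λ xs → distinct xs ∧ freshCommonLink B U (entries xs)) (λ i → s (suc i))
    box = boxes (λ xs → distinct xs ∧ freshCommonLink B U (entries xs))
            (≤-trans dense (*-monoʳ-≤ D (count-sets≤count-tuples n k (freshCommonLink B U)
              (λ q → freshCommonLink-size {B} U q (≤-trans (s≤s z≤n) (≤-reflexive (sym ∣B∣≡s₁)))))))

    module New = FromBox s r≥2 B U (trans ∣B∣≡s₁ (sym s₀≡1+t₁)) s-pos box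
    open Box box using () renaming (side to A; side-size to ∣A∣≡s)

    R′ : Subset m
    R′ = R ─ B
    U′ : Subset n
    U′ = U ∪ ⋃ (List.map A (allFin k))

    ∣R′∣+s₁≡∣R∣ : ∣ R′ ∣ + s₁ ≡ ∣ R ∣
    ∣R′∣+s₁≡∣R∣ = trans (cong (∣ R′ ∣ +_) (sym ∣B∣≡s₁)) (∣p─q∣+∣q∣≡∣p∣ R B B⊆R)

    ∣U′∣≤∣U∣+σ : ∣ U′ ∣ ≤ ∣ U ∣ + σ
    ∣U′∣≤∣U∣+σ = ≤-trans (∣p∪q∣≤∣p∣+∣q∣ U _) (+-monoʳ-≤ ∣ U ∣ (≤-trans (∣⋃∣≤∑∣∣ (List.map A (allFin k)))
                   (≤-reflexive (trans (∑-map ∣_∣ A (allFin k)) (trans (∑-cong (allFin k) ∣A∣≡s) σ≡)))))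

    room′ : ∀ j → suc j * s₁ ≤ ∣ R ∣ → j * s₁ ≤ ∣ R′ ∣
    room′ j room = +-cancelʳ-≤ s₁ _ _ (≤-trans (≤-reflexive (+-comm (j * s₁) s₁)) (≤-trans room (≤-reflexive (sym ∣R′∣+s₁≡∣R∣))))

    budget′ : s₁ * ∣ U ∣ + σ * ∣ R ∣ ≤ σ * m → s₁ * ∣ U′ ∣ + σ * ∣ R′ ∣ ≤ σ * m
    budget′ budget = begin
      s₁ * ∣ U′ ∣ + σ * ∣ R′ ∣             ≤⟨ +-monoˡ-≤ (σ * ∣ R′ ∣) (*-monoʳ-≤ s₁ ∣U′∣≤∣U∣+σ) ⟩
      s₁ * (∣ U ∣ + σ) + σ * ∣ R′ ∣        ≡⟨ regroup s₁ (∣ U ∣) σ (∣ R′ ∣) ⟩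
      s₁ * ∣ U ∣ + σ * (∣ R′ ∣ + s₁)       ≡⟨ cong (λ r → s₁ * ∣ U ∣ + σ * r) ∣R′∣+s₁≡∣R∣ ⟩
      s₁ * ∣ U ∣ + σ * ∣ R ∣               ≤⟨ budget ⟩
      σ * m                                ∎
      where
      regroup : ∀ s u σ r → s * (u + σ) + σ * r ≡ s * u + σ * (r + s)
      regroup = solve-∀

    A⊆U′ : ∀ i y → lookup (A i) y ≡ true → lookup U′ y ≡ true
    A⊆U′ i y Aᵢy = trans (lookup-∪ U _ y) (trans (cong (lookup U y ∨_) (lookup-⋃ _ (∈-map⁺ A (∈-allFin i)) Aᵢy)) (Bool.∨-zeroʳ _))

    B∩R′≡∅ : ∀ v → lookup B v ≡ true → lookup R′ v ≡ false
    B∩R′≡∅ v Bᵥ = trans (lookup-─ R B v) (trans (cong (λ b → lookup R v ∧ not b) Bᵥ) (∧-zeroʳ _))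

    extend : ∀ {j} → Packing R′ U′ j → Packing R U (suc j)
    extend {j} rest = record { copies = copies ; disjoint = disjoint ; V1-in-R = V1-in-R ; V2-avoid-U = V2-avoid-U }
      where
      module Rest = Packing rest
      new-vs-rest : ∀ b i i′ → Empty (part New.copy i ∩ part (Rest.copies b) i′)
      new-vs-rest b = parts-disjoint-from B A R′ U′ (part (Rest.copies b)) B∩R′≡∅ A⊆U′ (Rest.V1-in-R b) (Rest.V2-avoid-U b)
      copies : Fin (suc j) → OrderedCopy H s r≥2
      copies zero = New.copy
      copies (suc a) = Rest.copies a
      disjoint : ∀ a b → a ≢ b → ∀ i i′ → Empty (part (copies a) i ∩ part (copies b) i′)
      disjoint zero zero a≢b = contradiction refl a≢b
      disjoint zero (suc b) _ i i′ = new-vs-rest b i i′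
      disjoint (suc a) zero _ i i′ = Empty-∩-comm (part New.copy i′) (part (Rest.copies a) i) (new-vs-rest a i′ i)
      disjoint (suc a) (suc b) a≢b = Rest.disjoint a b (a≢b ∘ cong suc)
      V1-in-R : ∀ a x → lookup (part (copies a) zero) x ≡ true → ∃ λ v → x ≡ v ↑ˡ n × lookup R v ≡ true
      V1-in-R zero x x∈ = let v , eq , Bᵥ = lookup-++⊥ B x x∈ in v , eq , ⊆ᵇ-sound B R B⊆R Bᵥ
      V1-in-R (suc a) x x∈ = let v , eq , R′ᵥ = Rest.V1-in-R a x x∈ in v , eq , ∧-conicalˡ _ _ (trans (sym (lookup-─ R B v)) R′ᵥ)
      V2-avoid-U : ∀ a i x → lookup (part (copies a) (suc i)) x ≡ true → ∃ λ y → x ≡ m ↑ʳ y × lookup U y ≡ false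
      V2-avoid-U zero i x x∈ = let y , eq , Aᵢy = lookup-⊥++ (A i) x x∈ in y , eq , New.avoids-U i y Aᵢy
      V2-avoid-U (suc a) i x x∈ = let y , eq , U′y = Rest.V2-avoid-U a i x x∈ in
        y , eq , Bool.∨-conicalˡ _ _ (trans (sym (lookup-∪ U _ y)) U′y)

  -- The budget is kept because a step moves s₁ vertices out of R and at most σ vertices into U;
  -- it bounds s₁ ∣ U ∣ by σ m, as few-meeting requires.
  greedy : ∀ j R U → j * s₁ ≤ ∣ R ∣ → balanced R → s₁ * ∣ U ∣ + σ * ∣ R ∣ ≤ σ * m → Packing R U j
  greedy zero R U _ _ _ = record { copies = λ () ; disjoint = λ () ; V1-in-R = λ () ; V2-avoid-U = λ () }
  greedy (suc j) R U room bal budget = extend (greedy j R′ U′ (room′ j room) balanced-rest (budget′ budget))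
    where
    st : Step R U
    st = step j R U room bal (≤-trans (m≤m+n _ _) budget)
    open Step st using (balanced-rest)
    open Extend st

module ClearDenominators where
  open import Data.Nat.Coprimality as Coprime using (1-coprimeTo)
  open import Data.Integer as ℤ using (+_)
  open import Data.Integer.Properties as ℤ using (pos-*; pos-+; drop‿+≤+)
  open import Data.Rational using (mkℚ)
  import Data.Rational.Properties as ℚ
  open import Data.Rational.Unnormalised as ℚᵘ using (ℚᵘ; mkℚᵘ; *≤*)
  import Data.Rational.Unnormalised.Properties as ℚᵘ
  import Data.Sign as Sign

  numerator : ℚ → ℕ
  numerator α = ℤ.∣ ℚ.↥ α ∣

  denominator : ℚ → ℕ
  denominator α = ℚ.↧ₙ α

  numerator-pos : ∀ {α} → 0ℚ ℚ.< α → 1 ≤ numerator α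
  numerator-pos {mkℚ (+ suc _) _ _} _ = s≤s z≤n
  numerator-pos {mkℚ (+ zero) _ _} (ℚ.*<* (ℤ.+<+ ()))
  numerator-pos {mkℚ ℤ.-[1+ _ ] _ _} (ℚ.*<* ())

  toℚᵘ-ℕ→ℚ : ∀ x → ℚ.toℚᵘ (ℕ→ℚ x) ≡ mkℚᵘ (+ x) 0
  toℚᵘ-ℕ→ℚ x = cong ℚ.toℚᵘ (ℚ.normalize-coprime (Coprime.sym (1-coprimeTo x)))

  toℚᵘ-*ℕ→ℚ : ∀ α y → ℚ.toℚᵘ (α ℚ.* ℕ→ℚ y) ℚᵘ.≃ ℚ.toℚᵘ α ℚᵘ.* mkℚᵘ (+ y) 0
  toℚᵘ-*ℕ→ℚ α y = ℚᵘ.≃-trans (ℚ.toℚᵘ-homo-* α (ℕ→ℚ y)) (ℚᵘ.≃-reflexive (cong (ℚ.toℚᵘ α ℚᵘ.*_) (toℚᵘ-ℕ→ℚ y)))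

  toℚᵘ-≤ : ∀ {a b a' b'} → a ℚ.≤ b → ℚ.toℚᵘ a ℚᵘ.≃ a' → ℚ.toℚᵘ b ℚᵘ.≃ b' → a' ℚᵘ.≤ b'
  toℚᵘ-≤ a≤b a≃ b≃ = ℚᵘ.≤-respʳ-≃ b≃ (ℚᵘ.≤-respˡ-≃ a≃ (ℚ.toℚᵘ-mono-≤ a≤b))

  toℚᵘ-ℕ→ℚ≃ : ∀ x → ℚ.toℚᵘ (ℕ→ℚ x) ℚᵘ.≃ mkℚᵘ (+ x) 0
  toℚᵘ-ℕ→ℚ≃ x = ℚᵘ.≃-reflexive (toℚᵘ-ℕ→ℚ x)

  -- the shapes in which *≤* presents the cross products of n / 1 and (p / d) * (y / 1)
  +*+[1+d*1]≡+ : ∀ x d-1 → + x ℤ.* + suc (d-1 * 1) ≡ + (x * suc d-1)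
  +*+[1+d*1]≡+ x d-1 = trans (sym (pos-* x _)) (cong (λ e → + (x * suc e)) (*-identityʳ d-1))

  +◃*1≡+ : ∀ a → (Sign.+ ℤ.◃ a) ℤ.* + 1 ≡ + a
  +◃*1≡+ a = trans (ℤ.*-identityʳ _) (ℤ.+◃n≡+n a)

  ℕ→ℚ≤α*ℕ→ℚ⇒ : ∀ {α} → 0ℚ ℚ.< α → ∀ x y → ℕ→ℚ x ℚ.≤ α ℚ.* ℕ→ℚ y →
                x * denominator α ≤ numerator α * y
  ℕ→ℚ≤α*ℕ→ℚ⇒ {α@(mkℚ (+ p) d-1 _)} _ x y le with toℚᵘ-≤ le (toℚᵘ-ℕ→ℚ≃ x) (toℚᵘ-*ℕ→ℚ α y)
  ... | *≤* z = drop‿+≤+ (subst₂ ℤ._≤_ (+*+[1+d*1]≡+ x d-1) (+◃*1≡+ (p * y)) z)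
  ℕ→ℚ≤α*ℕ→ℚ⇒ {mkℚ ℤ.-[1+ _ ] _ _} (ℚ.*<* ()) _ _ _

  α*ℕ→ℚ≤ℕ→ℚ⇒ : ∀ {α} → 0ℚ ℚ.< α → ∀ x y → α ℚ.* ℕ→ℚ y ℚ.≤ ℕ→ℚ x →
                numerator α * y ≤ x * denominator α
  α*ℕ→ℚ≤ℕ→ℚ⇒ {α@(mkℚ (+ p) d-1 _)} _ x y le with toℚᵘ-≤ le (toℚᵘ-*ℕ→ℚ α y) (toℚᵘ-ℕ→ℚ≃ x)
  ... | *≤* z = drop‿+≤+ (subst₂ ℤ._≤_ (+◃*1≡+ (p * y)) (+*+[1+d*1]≡+ x d-1) z)
  α*ℕ→ℚ≤ℕ→ℚ⇒ {mkℚ ℤ.-[1+ _ ] _ _} (ℚ.*<* ()) _ _ _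

  ℕ→ℚ≤ℕ→ℚ+α*ℕ→ℚ⇒ : ∀ {α} → 0ℚ ℚ.< α → ∀ a b y → ℕ→ℚ a ℚ.≤ ℕ→ℚ b ℚ.+ α ℚ.* ℕ→ℚ y →
                     a * denominator α ≤ b * denominator α + numerator α * y
  ℕ→ℚ≤ℕ→ℚ+α*ℕ→ℚ⇒ {α@(mkℚ (+ p) d-1 _)} _ a b y le
    with toℚᵘ-≤ le (toℚᵘ-ℕ→ℚ≃ a) (ℚᵘ.≃-trans (ℚ.toℚᵘ-homo-+ (ℕ→ℚ b) _) (ℚᵘ.+-cong (toℚᵘ-ℕ→ℚ≃ b) (toℚᵘ-*ℕ→ℚ α y)))
  ... | *≤* z = drop‿+≤+ (subst₂ ℤ._≤_ lhs rhs z)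
    where
    lhs : + a ℤ.* + suc (d-1 * 1 + 0) ≡ + (a * suc d-1)
    lhs = trans (cong (λ e → + a ℤ.* + suc e) (+-identityʳ _)) (+*+[1+d*1]≡+ a d-1)
    rhs : (+ b ℤ.* + suc (d-1 * 1) ℤ.+ (Sign.+ ℤ.◃ (p * y)) ℤ.* + 1) ℤ.* + 1 ≡ + (b * suc d-1 + p * y)
    rhs = trans (ℤ.*-identityʳ _) (trans (cong₂ ℤ._+_ (+*+[1+d*1]≡+ b d-1) (+◃*1≡+ (p * y))) (sym (pos-+ (b * suc d-1) (p * y))))
  ℕ→ℚ≤ℕ→ℚ+α*ℕ→ℚ⇒ {mkℚ ℤ.-[1+ _ ] _ _} (ℚ.*<* ()) _ _ _ _

open ClearDenominators
  using (numerator; denominator; numerator-pos; ℕ→ℚ≤α*ℕ→ℚ⇒; α*ℕ→ℚ≤ℕ→ℚ⇒; ℕ→ℚ≤ℕ→ℚ+α*ℕ→ℚ⇒)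

x<[x/p+1]*p : ∀ x p .{{_ : NonZero p}} → x < (x / p + 1) * p
x<[x/p+1]*p x p = begin-strict
  x                      ≡⟨ m≡m%n+[m/n]*n x p ⟩
  x % p + x / p * p      <⟨ +-monoˡ-< (x / p * p) (m%n<n x p) ⟩
  p + x / p * p          ≡⟨ +-comm p _ ⟩
  x / p * p + p          ≡⟨ cong (x / p * p +_) (sym (*-identityˡ p)) ⟩
  x / p * p + 1 * p      ≡⟨ *-distribʳ-+ p (x / p) 1 ⟨
  (x / p + 1) * p        ∎
  where open ≤-Reasoning

[x/p+1]*p≤x+p : ∀ x p .{{_ : NonZero p}} → (x / p + 1) * p ≤ x + p
[x/p+1]*p≤x+p x p = begin
  (x / p + 1) * p        ≡⟨ *-distribʳ-+ p (x / p) 1 ⟩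
  x / p * p + 1 * p      ≤⟨ +-mono-≤ (m/n*n≤m x p) (≤-reflexive (*-identityˡ p)) ⟩
  x + p                  ∎
  where open ≤-Reasoning

floorDiv*≤ : ∀ m d (d≥2 : 2 ≤ d) → floorDiv m d d≥2 * d ≤ m
floorDiv*≤ m (suc d) _ = m/n*n≤m m (suc d)

floorDiv-zero : ∀ d (d≥2 : 2 ≤ d) → floorDiv 0 d d≥2 ≡ 0
floorDiv-zero (suc d) _ = 0/n≡0 (suc d)

toℕ-↑ʳ-<ᵇ : ∀ m {n} (j : Fin n) → (toℕ (m ↑ʳ j) <ᵇ m) ≡ false
toℕ-↑ʳ-<ᵇ zero j = refl
toℕ-↑ʳ-<ᵇ (suc m) j = toℕ-↑ʳ-<ᵇ m j

inL-V2 : ∀ {r m n} (H : SemibipartiteGraph r m n) s₁ α (j : Fin n) → inL H s₁ α (m ↑ʳ j) ≡ false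
inL-V2 {m = m} H s₁ α j rewrite toℕ-↑ʳ-<ᵇ m j = refl

sizeL≡∣L∣ : ∀ {r m n} (H : SemibipartiteGraph r m n) s₁ α →
            sizeL H s₁ α ≡ ∣ tabulate (λ v → inL H s₁ α (v ↑ˡ n)) ∣
sizeL≡∣L∣ {m = m} {n} H s₁ α = begin
  sizeL H s₁ α
    ≡⟨ sum-map≡∑ _ (allFin (m + n)) ⟩
  countᵇ (inL H s₁ α) (allFin (m + n))
    ≡⟨ ∑-tabulate-+ m n _ (λ v → v) ⟩
  countᵇ (inL H s₁ α) (List.tabulate (_↑ˡ n)) + countᵇ (inL H s₁ α) (List.tabulate (m ↑ʳ_))
    ≡⟨ cong (countᵇ (inL H s₁ α) (List.tabulate (_↑ˡ n)) +_)
            (∑-tabulate-zero n _ (m ↑ʳ_) (λ j → cong 𝟙 (inL-V2 H s₁ α j))) ⟩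
  countᵇ (inL H s₁ α) (List.tabulate (_↑ˡ n)) + 0
    ≡⟨ +-identityʳ _ ⟩
  countᵇ (inL H s₁ α) (List.tabulate (_↑ˡ n))
    ≡⟨ ∣tabulate∣≡countᵇ m (_↑ˡ n) (inL H s₁ α) ⟨
  ∣ tabulate (λ v → inL H s₁ α (v ↑ˡ n)) ∣ ∎
  where open ≡-Reasoning

a[c+x]d≤acd+P⇒adx≤P : ∀ a c x d P → a * (c + x) * d ≤ a * c * d + P → a * d * x ≤ P
a[c+x]d≤acd+P⇒adx≤P a c x d P h = +-cancelˡ-≤ (a * c * d) _ _ (≤-trans (≤-reflexive (expand a c x d)) h)
  where
  expand : ∀ a c x d → a * c * d + a * d * x ≡ a * (c + x) * d
  expand = solve-∀

tT≤L : ∀ t T p d L → 1 ≤ p → p ≤ d → T * p ≤ 4 * t * d + p → 5 * suc t * t * d ≤ p * L → t * T ≤ L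
tT≤L t T p d L p≥1 p≤d Tp≤ 5[1+t]td≤pL = *-cancelˡ-≤ p {{>-nonZero p≥1}} (begin
  p * (t * T)                                  ≡⟨ regroup₁ p t T ⟩
  t * (T * p)                                  ≤⟨ *-monoʳ-≤ t Tp≤ ⟩
  t * (4 * t * d + p)                          ≤⟨ *-monoʳ-≤ t (+-monoʳ-≤ (4 * t * d) p≤d) ⟩
  t * (4 * t * d + d)                          ≤⟨ m≤m+n _ (t * t * d + 4 * t * d) ⟩
  t * (4 * t * d + d) + (t * t * d + 4 * t * d) ≡⟨ regroup₂ t d ⟩
  5 * suc t * t * d                            ≤⟨ 5[1+t]td≤pL ⟩
  p * L                                        ∎)
  where
  open ≤-Reasoning
  regroup₁ : ∀ p t T → p * (t * T) ≡ t * (T * p)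
  regroup₁ = solve-∀
  regroup₂ : ∀ t d → t * (4 * t * d + d) + (t * t * d + 4 * t * d) ≡ 5 * suc t * t * d
  regroup₂ = solve-∀

module Setup {k′} (s : Fin (suc (suc k′)) → ℕ) (s-mono : ∀ i j → i Fin.≤ j → s i ≤ s j) (s₁≥2 : 2 ≤ s zero)
             (α : ℚ) (α>0 : 0ℚ ℚ.< α) where

  k s₁ t₁ p d σ : ℕ
  k = suc k′
  s₁ = s zero
  t₁ = s₁ ∸ 1
  p = numerator α
  d = denominator α
  σ = sumFin s ∸ s₁

  s₁≡1+t₁ : s₁ ≡ suc t₁
  s₁≡1+t₁ = sym (m+[n∸m]≡n (≤-trans (s≤s z≤n) s₁≥2))

  t₁≥1 : 1 ≤ t₁
  t₁≥1 = ∸-monoˡ-≤ 1 s₁≥2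

  s-pos : ∀ i → 1 ≤ s (suc i)
  s-pos i = ≤-trans (≤-trans (s≤s z≤n) s₁≥2) (s-mono zero (suc i) z≤n)

  p≥1 : 1 ≤ p
  p≥1 = numerator-pos α>0

  instance
    p≢0 : NonZero p
    p≢0 = >-nonZero p≥1

  σ≡ : ∑ (λ i → s (suc i)) (allFin k) ≡ σ
  σ≡ = sym (trans (cong (_∸ s₁) (trans (sum-map≡∑ s (allFin (suc k))) (cong (s₁ +_) (∑-tabulate k s suc))))
                  (m+n∸m≡n s₁ _))

  -- the least integer above 4 t₁ / α
  τ : ℕ
  τ = 4 * t₁ * d / p + 1

  4t₁d<τp : 4 * t₁ * d < τ * p
  4t₁d<τp = x<[x/p+1]*p (4 * t₁ * d) p

  1+t₁≤τ : p ≤ d → suc t₁ ≤ τ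
  1+t₁≤τ p≤d with τ ≤? 4 * t₁
  ... | yes τ≤4t₁ = contradiction (<-≤-trans 4t₁d<τp (≤-trans (*-monoˡ-≤ p τ≤4t₁) (*-monoʳ-≤ (4 * t₁) p≤d))) (<-irrefl refl)
  ... | no τ≰4t₁ = ≤-trans (s≤s (m≤n*m t₁ 4)) (≰⇒> τ≰4t₁)

  boxes : Σ ℕ λ n₀ → ∀ n → n₀ ≤ n → (G : Vec (Fin n) k → Bool) →
          n ^ k ≤ 8 * suc t₁ * d * (τ C suc t₁) * countᵇ G (allTuples n k) → Box G (λ i → s (suc i))
  boxes = dense⇒box k (λ i → s (suc i)) (8 * suc t₁ * d * (τ C suc t₁))

  -- the successor makes n positive, which p≤d needs
  n₀ : ℕ
  n₀ = suc (proj₁ boxes)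

  module Instance (n : ℕ) (n₀≤n : n₀ ≤ n) (m : ℕ) (H : SemibipartiteGraph (suc k) (suc m) n) where
    open Link H

    L : Subset (suc m)
    L = tabulate (λ v → inL H s₁ α (v ↑ˡ n))

    kSet : Subset n → Bool
    kSet q = ∣ q ∣ ≡ᵇ k

    m-small : ℕ→ℚ (8 * σ * suc m) ℚ.≤ α ℚ.* ℕ→ℚ n → 8 * σ * suc m * d ≤ p * n
    m-small = ℕ→ℚ≤α*ℕ→ℚ⇒ α>0 (8 * σ * suc m) n

    degree-large : (∀ v → InV1 {suc m} {n} v → α ℚ.* ℕ→ℚ (n ^ k) ℚ.≤ ℕ→ℚ (degree H v)) →
                   ∀ v → p * n ^ k ≤ countᵇ (link v) (allSubsets n) * d
    degree-large large v = subst (λ x → p * n ^ k ≤ x * d) (degree≡countᵇ-link v)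
      (α*ℕ→ℚ≤ℕ→ℚ⇒ α>0 (degree H (v ↑ˡ n)) (n ^ k) (large (v ↑ˡ n) (subst (_< suc m) (sym (toℕ-↑ˡ v n)) (toℕ<n v))))

    #links+#non-links≡C : ∀ w → countᵇ (link w) (allSubsets n) + countᵇ (λ q → kSet q ∧ not (link w q)) (allSubsets n) ≡ n C k
    #links+#non-links≡C w = begin
      countᵇ (link w) (allSubsets n) + countᵇ (λ q → kSet q ∧ not (link w q)) (allSubsets n)
        ≡⟨ cong₂ _+_ (∑-cong (allSubsets n) links-are-kSets) refl ⟨
      countᵇ (λ q → kSet q ∧ link w q) (allSubsets n) + countᵇ (λ q → kSet q ∧ not (link w q)) (allSubsets n)
        ≡⟨ countᵇ-split kSet (link w) (allSubsets n) ⟨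
      countᵇ kSet (allSubsets n)
        ≡⟨ count-ofSize n k ⟩
      n C k ∎
      where
      open ≡-Reasoning
      links-are-kSets : ∀ q → 𝟙 (kSet q ∧ link w q) ≡ 𝟙 (link w q)
      links-are-kSets q with link w q in wq
      ... | false = cong 𝟙 (∧-zeroʳ (kSet q))
      ... | true rewrite link-size w q wq | ≡⇒≡ᵇ≡true {k} refl = refl

    L-almost-complete : ∀ w → lookup L w ≡ true →
      2 * suc t₁ * d * countᵇ (λ q → kSet q ∧ not (link w q)) (allSubsets n) ≤ p * n ^ k
    L-almost-complete w Lw = subst (λ x → 2 * x * d * #non-links ≤ p * n ^ k) s₁≡1+t₁
      (a[c+x]d≤acd+P⇒adx≤P (2 * s₁) #links #non-links d (p * n ^ k)
        (subst₂ (λ c x → 2 * s₁ * c * d ≤ 2 * s₁ * x * d + p * n ^ k)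
                (sym (#links+#non-links≡C w)) (degree≡countᵇ-link w) (ℕ→ℚ≤ℕ→ℚ+α*ℕ→ℚ⇒ α>0 (2 * s₁ * (n C k)) (2 * s₁ * degree H (w ↑ˡ n)) (n ^ k) defining-inequality)))
      where
      #links #non-links : ℕ
      #links = countᵇ (link w) (allSubsets n)
      #non-links = countᵇ (λ q → kSet q ∧ not (link w q)) (allSubsets n)
      defining-inequality : ℕ→ℚ (2 * s₁ * (n C k)) ℚ.≤ ℕ→ℚ (2 * s₁ * degree H (w ↑ˡ n)) ℚ.+ α ℚ.* ℕ→ℚ (n ^ k)
      defining-inequality = does≡true⇒ (ℕ→ℚ (2 * s₁ * (n C k)) ℚ.≤? (ℕ→ℚ (2 * s₁ * degree H (w ↑ˡ n)) ℚ.+ α ℚ.* ℕ→ℚ (n ^ k)))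
        (∧-conicalʳ (toℕ (w ↑ˡ n) <ᵇ suc m) _ (trans (sym (lookup∘tabulate (λ v → inL H s₁ α (v ↑ˡ n)) w)) Lw))

    p≤d : (∀ v → p * n ^ k ≤ countᵇ (link v) (allSubsets n) * d) → p ≤ d
    p≤d large = *-cancelʳ-≤ p d (n ^ k) {{m^n≢0 n k {{>-nonZero (≤-trans (s≤s z≤n) n₀≤n)}}}}
      (≤-trans (large zero) (≤-trans (*-monoˡ-≤ d #links≤n^k) (≤-reflexive (*-comm (n ^ k) d))))
      where
      #links≤n^k : countᵇ (link zero) (allSubsets n) ≤ n ^ k
      #links≤n^k = ≤-trans (countᵇ-mono (allSubsets n) (λ q zq → ≡⇒≡ᵇ≡true (link-size zero q zq)))
                           (≤-trans (≤-reflexive (count-ofSize n k)) (C≤^ n k))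

    ∣L∣≡ : ∣ ⊤ ∩ L ∣ ≡ sizeL H s₁ α
    ∣L∣≡ = trans (cong ∣_∣ (∩-identityˡ L)) (sym (sizeL≡∣L∣ H s₁ α))

    initially-balanced : p ≤ d →
      ℕ→ℚ (5 * s₁ * (s₁ ∸ 1)) ℚ.≤ α ℚ.* ℕ→ℚ (sizeL H s₁ α) ⊎ (s₁ ∸ 1) * suc m ≤ s₁ * sizeL H s₁ α →
      t₁ * ∣ ⊤ ─ L ∣ ≤ ∣ ⊤ ∩ L ∣ ⊎ t₁ * τ ≤ ∣ ⊤ ∩ L ∣
    initially-balanced p≤d (inj₁ many-in-L) = inj₂ (tT≤L t₁ τ p d _ p≥1 p≤d ([x/p+1]*p≤x+p (4 * t₁ * d) p)
      (subst₂ (λ x y → 5 * x * t₁ * d ≤ p * y) s₁≡1+t₁ (sym ∣L∣≡) (ℕ→ℚ≤α*ℕ→ℚ⇒ α>0 (5 * s₁ * (s₁ ∸ 1)) (sizeL H s₁ α) many-in-L)))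
    initially-balanced p≤d (inj₂ most-in-L) = inj₁ (+-cancelˡ-≤ (t₁ * a) _ _ (begin
      t₁ * a + t₁ * b     ≡⟨ *-distribˡ-+ t₁ a b ⟨
      t₁ * (a + b)        ≡⟨ cong (t₁ *_) (trans (∣p∩q∣+∣p─q∣≡∣p∣ ⊤ L) (∣⊤∣≡n (suc m))) ⟩
      t₁ * suc m          ≤⟨ ≤-trans most-in-L (≤-reflexive (cong₂ _*_ s₁≡1+t₁ (sym ∣L∣≡))) ⟩
      suc t₁ * a          ≡⟨ +-comm a (t₁ * a) ⟩
      t₁ * a + a          ∎))
      where
      open ≤-Reasoning
      a b : ℕ
      a = ∣ ⊤ ∩ L ∣
      b = ∣ ⊤ ─ L ∣

    j : ℕ
    j = floorDiv (suc m) s₁ s₁≥2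

    room : j * suc t₁ ≤ ∣ ⊤ {suc m} ∣
    room = subst₂ (λ x y → j * x ≤ y) s₁≡1+t₁ (sym (∣⊤∣≡n (suc m))) (floorDiv*≤ (suc m) s₁ s₁≥2)

    budget : suc t₁ * ∣ ⊥ {n} ∣ + σ * ∣ ⊤ {suc m} ∣ ≤ σ * suc m
    budget = ≤-reflexive (trans (cong₂ (λ a b → suc t₁ * a + σ * b) (∣⊥∣≡0 n) (∣⊤∣≡n (suc m)))
                                (cong (_+ σ * suc m) (*-zeroʳ (suc t₁))))

    disjoint-copies : ℕ→ℚ (8 * σ * suc m) ℚ.≤ α ℚ.* ℕ→ℚ n →
      (∀ v → InV1 {suc m} {n} v → α ℚ.* ℕ→ℚ (n ^ k) ℚ.≤ ℕ→ℚ (degree H v)) →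
      (ℕ→ℚ (5 * s₁ * (s₁ ∸ 1)) ℚ.≤ α ℚ.* ℕ→ℚ (sizeL H s₁ α) ⊎ (s₁ ∸ 1) * suc m ≤ s₁ * sizeL H s₁ α) →
      DisjointCopies H s (s≤s (s≤s z≤n)) j
    disjoint-copies small large L-large = Packing.copies packed , Packing.disjoint packed
      where
      open Greedy H s t₁ s₁≡1+t₁ t₁≥1 s-pos p d σ τ σ≡ L p≥1 (degree-large large) L-almost-complete (m-small small)
                  (<⇒≤ 4t₁d<τp) (1+t₁≤τ (p≤d (degree-large large))) (proj₂ boxes n (≤-trans (n≤1+n _) n₀≤n))
      packed : Packing ⊤ ⊥ j
      packed = greedy j ⊤ ⊥ room (initially-balanced (p≤d (degree-large large)) L-large) budget

  packing : ∀ n → n₀ ≤ n → ∀ m (H : SemibipartiteGraph (suc k) m n) →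
    ℕ→ℚ (8 * σ * m) ℚ.≤ α ℚ.* ℕ→ℚ n →
    (∀ v → InV1 {m} {n} v → α ℚ.* ℕ→ℚ (n ^ k) ℚ.≤ ℕ→ℚ (degree H v)) →
    (ℕ→ℚ (5 * s₁ * (s₁ ∸ 1)) ℚ.≤ α ℚ.* ℕ→ℚ (sizeL H s₁ α) ⊎ (s₁ ∸ 1) * m ≤ s₁ * sizeL H s₁ α) →
    DisjointCopies H s (s≤s (s≤s z≤n)) (floorDiv m s₁ s₁≥2)
  packing n n₀≤n zero H _ _ _ = subst (DisjointCopies H s (s≤s (s≤s z≤n))) (sym (floorDiv-zero s₁ s₁≥2)) ((λ ()) , (λ ()))
  packing n n₀≤n (suc m) H = Instance.disjoint-copies n n₀≤n m H

lemma5p2 : (r : ℕ) (r≥2 : 2 ≤ r) (s : Fin r → ℕ) →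
    (∀ i j → i Fin.≤ j → s i ≤ s j) → (s₁≥2 : 2 ≤ s (first r≥2)) →
    (α : ℚ) → 0ℚ ℚ.< α →
    Σ ℕ λ n₀ → ∀ n → n₀ ≤ n → ∀ m (H : SemibipartiteGraph r m n) →
      ℕ→ℚ (8 * (sumFin s ∸ s (first r≥2)) * m) ℚ.≤ α ℚ.* ℕ→ℚ n →
      (∀ v → InV1 {m} {n} v → α ℚ.* ℕ→ℚ (n ^ (r ∸ 1)) ℚ.≤ ℕ→ℚ (degree H v)) →
      (ℕ→ℚ (5 * s (first r≥2) * (s (first r≥2) ∸ 1)) ℚ.≤ α ℚ.* ℕ→ℚ (sizeL H (s (first r≥2)) α)
        ⊎ (s (first r≥2) ∸ 1) * m ≤ s (first r≥2) * sizeL H (s (first r≥2)) α) →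
      DisjointCopies H s r≥2 (floorDiv m (s (first r≥2)) s₁≥2)
lemma5p2 (suc (suc k′)) (s≤s (s≤s z≤n)) s s-mono s₁≥2 α α>0 = n₀ , packing
  where open Setup s s-mono s₁≥2 α α>0
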